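{- (1) Let $D$ be a formula, $X$ an $n$-ary predicate variable or predicate symbol, and $A,B$ formulas with $A\subseteq B$. If $X$ is positive in $D$ then $D[A/X(x_1,\dots,x_n)]\subseteq D[B/X(x_1,\dots,x_n)]$; if $X$ is negative in $D$ then $D[B/X(x_1,\dots,x_n)]\subseteq D[A/X(x_1,\dots,x_n)]$. (2) The rule $(\mu'_g)$ can be eliminated: every instance $\mu Cx_1\dots x_nA\langle t_1,\dots,t_n\rangle\subseteq A[\mu Cx_1\dots x_nA\langle y_1,\dots,y_n\rangle/C(y_1,\dots,y_n)][t_1/x_1,\dots,t_n/x_n]$ is derivable without using $(\mu'_g)$.
   Context: Formulas. Second-order language with individual variables, function symbols (building terms), predicate symbols and predicate variables of every arity, logical symbols $\perp,\rightarrow,\forall,\mu$. Formulas: $\perp$; atomic $X(t_1,\dots,t_n)$; $A\rightarrow B$; $\forall xA$; $\forall XA$; $\mu Cx_1\dots x_nA\langle t_1,\dots,t_n\rangle$ with $C$ an $n$-ary predicate symbol appearing and positive in $A$ ($C,\bar x$ bound). Positivity of $X$ in $A$: if $X$ does not appear, both positive and negative; in $X(\bar t)$: positive, not negative; in $B\rightarrow C$: positive (negative) iff negative (positive) in $B$ and positive (negative) in $C$; in $\forall vB$ ($v\ne X$) and $\mu C\bar xB\langle\bar t\rangle$: as in $B$. $A[G/X(x_1,\dots,x_n)]$ replaces each atomic $X(t_1,\dots,t_n)$ in $A$ by $G[t_1/x_1,\dots,t_n/x_n]$ (renaming bound variables). Relation $\subseteq$ (fixed set $\mathbf E$ of equations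 between terms; a particular case of an equation of $\mathbf E$ is $u=v$ or $v=u$ with $u,v$ obtained from both sides of an equation of $\mathbf E$ by one substitution of terms for individual variables): least relation closed under (ax) $A\subseteq A$; from $A\subseteq A'$, $B\subseteq B'$ infer $A'\rightarrow B\subseteq A\rightarrow B'$; from $A[G/v]\subseteq B$ infer $\forall vA\subseteq B$ ($G$ a term if $v$ is an individual variable, a formula if $v$ is a predicate variable); from $A\subseteq B$ infer $A\subseteq\forall vB$ if $v$ not free in $A$; from $A\subseteq B[u/y]$ infer $A\subseteq B[w/y]$ if $u=w$ is a particular case of an equation of $\mathbf E$; transitivity; ($\mu_d$) $D[\mu Cx_1\dots x_mD\langle z_1,\dots,z_m\rangle/C(z_1,\dots,z_m)][t_1/x_1,\dots,t_m/x_m]\subseteq\mu Cx_1\dots x_mD\langle t_1,\dots,t_m\rangle$; ($\mu'_g$) the converse inclusion $\mu Cx_1\dots x_mD\langle t_1,\dots,t_m\rangle\subseteq D[\mu Cx_1\dots x_mD\langle z_1,\dots,z_m\rangle/C(z_1,\dots,z_m)][t_1/x_1,\dots,t_m/x_m]$; ($\mu_g$) from $D[F/C(x_1,\dots,x_m)]\subseteq F$ infer $\mu Cx_1\dots x_mD\langle t_1,\dots,t_m\rangle\subseteq F[t_1/x_1,\dots,t_m/x_m]$. -}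

module Defs where

open import Data.Nat using (ℕ; zero; suc; _+_; _≡ᵇ_)
open import Data.Bool using (Bool; true; false; if_then_else_; T)
open import Data.List using (List; []; _∷_)
open import Data.Vec using (Vec; []; _∷_; tabulate)
import Data.Vec as Vec
open import Data.Fin using (toℕ)
open import Data.Unit using (⊤)
open import Data.Empty using (⊥)
open import Data.Product using (Σ; _×_)
open import Data.Sum using (_⊎_)
open import Relation.Nullary using (¬_)
open import Relation.Binary.PropositionalEquality using (_≡_)

data Term : Set where
  var : ℕ → Term
  fn  : ℕ → List Term → Term

mutual
  renT : (ℕ → ℕ) → Term → Term
  renT f (var j)   = var (f j)
  renT f (fn s ts) = fn s (renTs f ts)

  renTs : (ℕ → ℕ) → List Term → List Term
  renTs f []       = []
  renTs f (t ∷ ts) = renT f t ∷ renTs f ts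

mutual
  substT : (ℕ → Term) → Term → Term
  substT σ (var j)   = σ j
  substT σ (fn s ts) = fn s (substTs σ ts)

  substTs : (ℕ → Term) → List Term → List Term
  substTs σ []       = []
  substTs σ (t ∷ ts) = substT σ t ∷ substTs σ ts

-- Formulas.
--  atom n k ts : the k-th (de Bruijn index among n-ary ones) n-ary
--                predicate variable/symbol applied to ts.
--  ∀i A        : ∀x A        (binds individual index 0)
--  ∀p n A      : ∀X A        (binds n-ary predicate index 0)
--  μ n A ts    : μ C x₁…xₙ A ⟨t₁,…,tₙ⟩  (binds n-ary predicate index 0 = C
--                and individual indices 0..n-1 = x₁..xₙ in A)

data Formula : Set where
  ⊥f   : Formula
  atom : (n k : ℕ) → Vec Term n → Formula
  _⇒_  : Formula → Formula → Formula
  ∀i   : Formula → Formula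
  ∀p   : ℕ → Formula → Formula
  μ    : (n : ℕ) → Formula → Vec Term n → Formula

infixr 5 _⇒_

allVars : (n : ℕ) → Vec Term n
allVars n = tabulate (λ i → var (toℕ i))

-- environment: indices < n go to ts, index n + j goes to σ j
vecEnv : {n : ℕ} → Vec Term n → (ℕ → Term) → ℕ → Term
vecEnv []       σ j       = σ j
vecEnv (t ∷ ts) σ zero    = t
vecEnv (t ∷ ts) σ (suc j) = vecEnv ts σ j

liftRen : ℕ → (ℕ → ℕ) → ℕ → ℕ
liftRen zero    f j       = f j
liftRen (suc m) f zero    = zero
liftRen (suc m) f (suc j) = suc (liftRen m f j)

liftSub : ℕ → (ℕ → Term) → ℕ → Term
liftSub zero    σ j       = σ j
liftSub (suc m) σ zero    = var zero
liftSub (suc m) σ (suc j) = renT suc (liftSub m σ j)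

renI : (ℕ → ℕ) → Formula → Formula
renI f ⊥f            = ⊥f
renI f (atom n k ts) = atom n k (Vec.map (renT f) ts)
renI f (A ⇒ B)       = renI f A ⇒ renI f B
renI f (∀i A)        = ∀i (renI (liftRen 1 f) A)
renI f (∀p n A)      = ∀p n (renI f A)
renI f (μ n A ts)    = μ n (renI (liftRen n f) A) (Vec.map (renT f) ts)

substI : (ℕ → Term) → Formula → Formula
substI σ ⊥f            = ⊥f
substI σ (atom n k ts) = atom n k (Vec.map (substT σ) ts)
substI σ (A ⇒ B)       = substI σ A ⇒ substI σ B
substI σ (∀i A)        = ∀i (substI (liftSub 1 σ) A)
substI σ (∀p n A)      = ∀p n (substI σ A)
substI σ (μ n A ts)    = μ n (substI (liftSub n σ) A) (Vec.map (substT σ) ts)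

-- A[u/y] where y is individual index 0 (and is removed)
inst1I : Term → Formula → Formula
inst1I u = substI (vecEnv (u ∷ []) var)

-- insert m fresh individual variables after the first m ones
wkParams : ℕ → Formula → Formula
wkParams m = renI (liftRen m (m +_))

-- index shift for n-ary predicates when passing an m-ary predicate binder
shiftPR : ℕ → ℕ → ℕ → ℕ
shiftPR m n k = if n ≡ᵇ m then suc k else k

liftIdx : (ℕ → ℕ) → ℕ → ℕ
liftIdx g zero    = zero
liftIdx g (suc k) = suc (g k)

liftPR : ℕ → (ℕ → ℕ → ℕ) → ℕ → ℕ → ℕ
liftPR m f n = if n ≡ᵇ m then liftIdx (f n) else f n

renP : (ℕ → ℕ → ℕ) → Formula → Formula
renP f ⊥f            = ⊥f
renP f (atom n k ts) = atom n (f n k) ts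
renP f (A ⇒ B)       = renP f A ⇒ renP f B
renP f (∀i A)        = ∀i (renP f A)
renP f (∀p m A)      = ∀p m (renP (liftPR m f) A)
renP f (μ m A ts)    = μ m (renP (liftPR m f) A) ts

-- A predicate substitution ρ assigns to the n-ary predicate with index k a
-- formula ρ n k whose individual indices 0..n-1 are the parameters x₁..xₙ
-- and whose index n + j is the ambient individual variable j.
PSub : Set
PSub = ℕ → ℕ → Formula

liftPSI : ℕ → PSub → PSub
liftPSI j ρ n k = renI (liftRen n (j +_)) (ρ n k)

liftPSP : ℕ → PSub → PSub
liftPSP m ρ n k = if n ≡ᵇ m then aux k else renP (shiftPR m) (ρ n k)
  where
  aux : ℕ → Formula
  aux zero    = atom n zero (allVars n)
  aux (suc k) = renP (shiftPR m) (ρ n k)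

substP : PSub → Formula → Formula
substP ρ ⊥f            = ⊥f
substP ρ (atom n k ts) = substI (vecEnv ts var) (ρ n k)
substP ρ (A ⇒ B)       = substP ρ A ⇒ substP ρ B
substP ρ (∀i A)        = ∀i (substP (liftPSI 1 ρ) A)
substP ρ (∀p m A)      = ∀p m (substP (liftPSP m ρ) A)
substP ρ (μ m A ts)    = μ m (substP (liftPSP m (liftPSI m ρ)) A) ts

-- A[G/X(x₁,…,xₙ)] where X is the n-ary predicate with index 0 (removed)
inst1 : ℕ → Formula → PSub
inst1 n G m k = if m ≡ᵇ n then aux k else atom m k (allVars m)
  where
  aux : ℕ → Formula
  aux zero    = G
  aux (suc k) = atom m k (allVars m)

substP1 : ℕ → Formula → Formula → Formula
substP1 n G A = substP (inst1 n G) A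

mutual
  Pos : ℕ → ℕ → Formula → Set
  Pos n k ⊥f            = ⊤
  Pos n k (atom m j ts) = ⊤
  Pos n k (A ⇒ B)       = Neg n k A × Pos n k B
  Pos n k (∀i A)        = Pos n k A
  Pos n k (∀p m A)      = Pos n (shiftPR m n k) A
  Pos n k (μ m A ts)    = Pos n (shiftPR m n k) A

  Neg : ℕ → ℕ → Formula → Set
  Neg n k ⊥f            = ⊤
  Neg n k (atom m j ts) = ¬ (m ≡ n × j ≡ k)
  Neg n k (A ⇒ B)       = Pos n k A × Neg n k B
  Neg n k (∀i A)        = Neg n k A
  Neg n k (∀p m A)      = Neg n (shiftPR m n k) A
  Neg n k (μ m A ts)    = Neg n (shiftPR m n k) A

Occurs : ℕ → ℕ → Formula → Set
Occurs n k ⊥f            = ⊥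
Occurs n k (atom m j ts) = m ≡ n × j ≡ k
Occurs n k (A ⇒ B)       = Occurs n k A ⊎ Occurs n k B
Occurs n k (∀i A)        = Occurs n k A
Occurs n k (∀p m A)      = Occurs n (shiftPR m n k) A
Occurs n k (μ m A ts)    = Occurs n (shiftPR m n k) A

WF : Formula → Set
WF ⊥f            = ⊤
WF (atom n k ts) = ⊤
WF (A ⇒ B)       = WF A × WF B
WF (∀i A)        = WF A
WF (∀p n A)      = WF A
WF (μ n A ts)    = Occurs n zero A × Pos n zero A × WF A

Particular : (Term → Term → Set) → Term → Term → Set
Particular E u w =
  Σ (ℕ → Term) λ σ → Σ Term λ l → Σ Term λ r → E l r ×
    ((u ≡ substT σ l × w ≡ substT σ r) ⊎ (u ≡ substT σ r × w ≡ substT σ l))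

-- μ C x̄ D ⟨z̄⟩ as a formula whose parameters are z̄
μParam : ℕ → Formula → Formula
μParam m D = μ m (wkParams m D) (allVars m)

-- D[μ C x̄ D ⟨z̄⟩ / C(z̄)][t̄/x̄]
unfold : (m : ℕ) → Formula → Vec Term m → Formula
unfold m D ts = substI (vecEnv ts var) (substP1 m (wkParams m (μParam m D)) D)

-- Incl E g A B : A ⊆ B ; the flag g says whether rule (μ'_g) is allowed.
data Incl (E : Term → Term → Set) (g : Bool) : Formula → Formula → Set where
  ax     : ∀ {A} → WF A → Incl E g A A
  arr    : ∀ {A A' B B'} → Incl E g A A' → Incl E g B B' →
           Incl E g (A' ⇒ B) (A ⇒ B')
  alliL  : ∀ {A B} (t : Term) → Incl E g (inst1I t A) B → Incl E g (∀i A) B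
  allpL  : ∀ {n A B} (G : Formula) → WF G →
           Incl E g (substP1 n G A) B → Incl E g (∀p n A) B
  alliR  : ∀ {A B} → Incl E g (renI suc A) B → Incl E g A (∀i B)
  allpR  : ∀ {n A B} → Incl E g (renP (shiftPR n) A) B → Incl E g A (∀p n B)
  eqn    : ∀ {A B u w} → Particular E u w →
           Incl E g A (inst1I u B) → Incl E g A (inst1I w B)
  trans  : ∀ {A B C} → Incl E g A B → Incl E g B C → Incl E g A C
  μd     : ∀ {m D ts} → WF (μ m D ts) → Incl E g (unfold m D ts) (μ m D ts)
  μg'    : ∀ {m D ts} → T g → WF (μ m D ts) → Incl E g (μ m D ts) (unfold m D ts)
  μg     : ∀ {m D F ts} → WF (μ m D ts) →
           Incl E g (substP1 m (wkParams m F) D) F →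
           Incl E g (μ m D ts) (substI (vecEnv ts var) F)

module Submission where

-- (1) is proved in a stronger form, `monotone`: for simultaneous predicate
-- substitutions ρ₁, ρ₂ that agree at every predicate except those at which
-- D has polarity s, and satisfy ρ₁ X ⊆ ρ₂ X there, D[ρ₁] ⊆ D[ρ₂] when s is
-- positive and D[ρ₂] ⊆ D[ρ₁] when s is negative.  Simultaneous substitutions
-- let the induction on D pass binders: under ∀X and μC the substitutions are
-- lifted, and a μ is compared through its body (`incl-μ-body`: μg then μd)
-- after instantiating its bound C.

open import Defs
open import Data.Nat using (ℕ; zero; suc; _+_; _≡ᵇ_; _≟_)
open import Data.Nat.Properties using (≡ᵇ⇒≡; ≡⇒≡ᵇ; suc-injective)
open import Data.Bool using (Bool; true; false; if_then_else_)
open import Data.Bool.Properties using (T-≡)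
open import Data.List using ([]; _∷_)
open import Data.Vec using (Vec; []; _∷_; lookup)
import Data.Vec as Vec
open import Data.Vec.Properties using (map-cong; map-∘; lookup-map; tabulate∘lookup; lookup∘tabulate; tabulate-∘; tabulate-cong)
open import Data.Fin using (Fin; toℕ) renaming (zero to fz; suc to fs)
open import Data.Unit using (tt)
open import Data.Empty using (⊥-elim)
open import Data.Product using (_×_; _,_; proj₁; proj₂)
open import Data.Sum using (_⊎_; inj₁; inj₂)
open import Relation.Nullary using (¬_; yes; no)
open import Relation.Binary.PropositionalEquality hiding (trans)
import Relation.Binary.PropositionalEquality as Eq
open import Function using (_∘_; Equivalence)

-- Transitivity of ≡ as an infix operator (the name `trans` is the
-- transitivity rule of ⊆ in Defs).
infixr 5 _∙_
_∙_ : ∀ {A : Set} {x y z : A} → x ≡ y → y ≡ z → x ≡ z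
_∙_ = Eq.trans

mutual
  substT-ext : ∀ {σ σ'} → σ ≗ σ' → ∀ t → substT σ t ≡ substT σ' t
  substT-ext e (var j) = e j
  substT-ext e (fn s ts) = cong (fn s) (substTs-ext e ts)

  substTs-ext : ∀ {σ σ'} → σ ≗ σ' → ∀ ts → substTs σ ts ≡ substTs σ' ts
  substTs-ext e [] = refl
  substTs-ext e (t ∷ ts) = cong₂ _∷_ (substT-ext e t) (substTs-ext e ts)

mutual
  substT-∘ : ∀ τ σ t → substT τ (substT σ t) ≡ substT (substT τ ∘ σ) t
  substT-∘ τ σ (var j) = refl
  substT-∘ τ σ (fn s ts) = cong (fn s) (substTs-∘ τ σ ts)

  substTs-∘ : ∀ τ σ ts → substTs τ (substTs σ ts) ≡ substTs (substT τ ∘ σ) ts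
  substTs-∘ τ σ [] = refl
  substTs-∘ τ σ (t ∷ ts) = cong₂ _∷_ (substT-∘ τ σ t) (substTs-∘ τ σ ts)

mutual
  renT≗substT : ∀ f t → renT f t ≡ substT (var ∘ f) t
  renT≗substT f (var j) = refl
  renT≗substT f (fn s ts) = cong (fn s) (renTs≗substTs f ts)

  renTs≗substTs : ∀ f ts → renTs f ts ≡ substTs (var ∘ f) ts
  renTs≗substTs f [] = refl
  renTs≗substTs f (t ∷ ts) = cong₂ _∷_ (renT≗substT f t) (renTs≗substTs f ts)

mutual
  substT-id : ∀ t → substT var t ≡ t
  substT-id (var j) = refl
  substT-id (fn s ts) = cong (fn s) (substTs-id ts)

  substTs-id : ∀ ts → substTs var ts ≡ ts
  substTs-id [] = refl
  substTs-id (t ∷ ts) = cong₂ _∷_ (substT-id t) (substTs-id ts)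

renT-∘ : ∀ g f t → renT g (renT f t) ≡ renT (g ∘ f) t
renT-∘ g f t = renT≗substT g _ ∙ cong (substT (var ∘ g)) (renT≗substT f t) ∙
   substT-∘ _ _ t ∙ sym (renT≗substT (g ∘ f) t)

substT-renT : ∀ σ f t → substT σ (renT f t) ≡ substT (σ ∘ f) t
substT-renT σ f t = cong (substT σ) (renT≗substT f t) ∙ substT-∘ σ _ t

renT-substT : ∀ f σ t → renT f (substT σ t) ≡ substT (renT f ∘ σ) t
renT-substT f σ t = renT≗substT f _ ∙ substT-∘ _ σ t ∙ substT-ext (λ j → sym (renT≗substT f (σ j))) t

liftSub-ext : ∀ m {σ σ'} → σ ≗ σ' → liftSub m σ ≗ liftSub m σ'
liftSub-ext zero e j = e j
liftSub-ext (suc m) e zero = refl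
liftSub-ext (suc m) e (suc j) = cong (renT suc) (liftSub-ext m e j)

liftSub-var : ∀ m f j → liftSub m (var ∘ f) j ≡ var (liftRen m f j)
liftSub-var zero f j = refl
liftSub-var (suc m) f zero = refl
liftSub-var (suc m) f (suc j) = cong (renT suc) (liftSub-var m f j)

liftSub-id : ∀ m → liftSub m var ≗ var
liftSub-id zero j = refl
liftSub-id (suc m) zero = refl
liftSub-id (suc m) (suc j) = cong (renT suc) (liftSub-id m j)

liftSub-∘ : ∀ m τ σ j → liftSub m (substT τ ∘ σ) j ≡ substT (liftSub m τ) (liftSub m σ j)
liftSub-∘ zero τ σ j = refl
liftSub-∘ (suc m) τ σ zero = refl
liftSub-∘ (suc m) τ σ (suc j) =
  cong (renT suc) (liftSub-∘ m τ σ j) ∙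
   renT-substT suc (liftSub m τ) (liftSub m σ j) ∙ sym (substT-renT (liftSub (suc m) τ) suc (liftSub m σ j))

liftSub-+ : ∀ m σ j → liftSub m σ (m + j) ≡ renT (m +_) (σ j)
liftSub-+ zero σ j = sym (renT≗substT (λ x → x) (σ j) ∙ substT-id (σ j))
liftSub-+ (suc m) σ j = cong (renT suc) (liftSub-+ m σ j) ∙ renT-∘ suc (m +_) (σ j)

liftSub-lo : ∀ m σ (i : Fin m) → liftSub m σ (toℕ i) ≡ var (toℕ i)
liftSub-lo (suc m) σ fz = refl
liftSub-lo (suc m) σ (fs i) = cong (renT suc) (liftSub-lo m σ i)

liftRen-+ : ∀ m f j → liftRen m f (m + j) ≡ m + f j
liftRen-+ zero f j = refl
liftRen-+ (suc m) f j = cong suc (liftRen-+ m f j)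

liftRen-lo : ∀ m f (i : Fin m) → liftRen m f (toℕ i) ≡ toℕ i
liftRen-lo (suc m) f fz = refl
liftRen-lo (suc m) f (fs i) = cong suc (liftRen-lo m f i)

vecEnv-+ : ∀ {n} (ts : Vec Term n) σ j → vecEnv ts σ (n + j) ≡ σ j
vecEnv-+ [] σ j = refl
vecEnv-+ (t ∷ ts) σ j = vecEnv-+ ts σ j

vecEnv-lo : ∀ {n} (ts : Vec Term n) σ (i : Fin n) → vecEnv ts σ (toℕ i) ≡ lookup ts i
vecEnv-lo (t ∷ ts) σ fz = refl
vecEnv-lo (t ∷ ts) σ (fs i) = vecEnv-lo ts σ i

data Split (m : ℕ) : ℕ → Set where
  lo : (i : Fin m) → Split m (toℕ i)
  hi : (p : ℕ) → Split m (m + p)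

split : ∀ m j → Split m j
split zero j = hi j
split (suc m) zero = lo fz
split (suc m) (suc j) with split m j
... | lo i = lo (fs i)
... | hi p = hi p

map-allVars : ∀ {n} (σ : ℕ → Term) → (∀ (i : Fin n) → σ (toℕ i) ≡ var (toℕ i)) →
  Vec.map (substT σ) (allVars n) ≡ allVars n
map-allVars {n} σ e = sym (tabulate-∘ (substT σ) (λ i → var (toℕ i))) ∙ tabulate-cong e

map-allVars-env : ∀ {n} (ts : Vec Term n) σ → Vec.map (substT (vecEnv ts σ)) (allVars n) ≡ ts
map-allVars-env {n} ts σ = sym (tabulate-∘ (substT (vecEnv ts σ)) (λ i → var (toℕ i))) ∙
  tabulate-cong (vecEnv-lo ts σ) ∙ tabulate∘lookup ts

map-allVars-ren : ∀ {n} f → (∀ (i : Fin n) → f (toℕ i) ≡ toℕ i) →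
  Vec.map (renT f) (allVars n) ≡ allVars n
map-allVars-ren {n} f e = sym (tabulate-∘ (renT f) (λ i → var (toℕ i))) ∙ tabulate-cong (λ i → cong var (e i))

≢⇒≡ᵇfalse : ∀ n m → ¬ (n ≡ m) → (n ≡ᵇ m) ≡ false
≢⇒≡ᵇfalse n m ne with n ≡ᵇ m | ≡ᵇ⇒≡ n m
... | false | _ = refl
... | true | f = ⊥-elim (ne (f tt))

≡ᵇ-refl : ∀ m → (m ≡ᵇ m) ≡ true
≡ᵇ-refl m = Equivalence.to T-≡ (≡⇒≡ᵇ m m refl)

if-true : ∀ {A : Set} {b} {x y : A} → b ≡ true → (if b then x else y) ≡ x
if-true refl = refl

if-false : ∀ {A : Set} {b} {x y : A} → b ≡ false → (if b then x else y) ≡ y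
if-false refl = refl

shift-eq : ∀ m k → shiftPR m m k ≡ suc k
shift-eq m k = if-true (≡ᵇ-refl m)

shift-neq : ∀ m n k → ¬ (n ≡ m) → shiftPR m n k ≡ k
shift-neq m n k ne = if-false (≢⇒≡ᵇfalse n m ne)

liftPR-eq : ∀ m f k → liftPR m f m k ≡ liftIdx (f m) k
liftPR-eq m f k = cong (λ h → h k) (if-true {x = liftIdx (f m)} {y = f m} (≡ᵇ-refl m))

liftPR-neq : ∀ m f n k → ¬ (n ≡ m) → liftPR m f n k ≡ f n k
liftPR-neq m f n k ne = cong (λ h → h k) (if-false {x = liftIdx (f n)} {y = f n} (≢⇒≡ᵇfalse n m ne))

liftPSP-eq0 : ∀ m ρ → liftPSP m ρ m zero ≡ atom m zero (allVars m)
liftPSP-eq0 m ρ = if-true (≡ᵇ-refl m)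

liftPSP-eqS : ∀ m ρ k → liftPSP m ρ m (suc k) ≡ renP (shiftPR m) (ρ m k)
liftPSP-eqS m ρ k = if-true (≡ᵇ-refl m)

liftPSP-neq : ∀ m ρ n k → ¬ (n ≡ m) → liftPSP m ρ n k ≡ renP (shiftPR m) (ρ n k)
liftPSP-neq m ρ n k ne = if-false (≢⇒≡ᵇfalse n m ne)

inst1-eq0 : ∀ n G → inst1 n G n zero ≡ G
inst1-eq0 n G = if-true (≡ᵇ-refl n)

inst1-eqS : ∀ n G k → inst1 n G n (suc k) ≡ atom n k (allVars n)
inst1-eqS n G k = if-true (≡ᵇ-refl n)

inst1-neq : ∀ n G m k → ¬ (m ≡ n) → inst1 n G m k ≡ atom m k (allVars m)
inst1-neq n G m k ne = if-false (≢⇒≡ᵇfalse m n ne)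

data PredIndex (m : ℕ) : ℕ → ℕ → Set where
  bound : PredIndex m m zero
  outer : ∀ k → PredIndex m m (suc k)
  other : ∀ {n} k → ¬ n ≡ m → PredIndex m n k

predIndex : ∀ m n k → PredIndex m n k
predIndex m n k with n ≟ m
predIndex m n zero | yes refl = bound
predIndex m n (suc k) | yes refl = outer k
... | no ne = other k ne

map-substT-∘ : ∀ {n} τ σ (ts : Vec Term n) → Vec.map (substT τ) (Vec.map (substT σ) ts) ≡ Vec.map (substT (substT τ ∘ σ)) ts
map-substT-∘ τ σ ts = sym (map-∘ (substT τ) (substT σ) ts) ∙ map-cong (substT-∘ τ σ) ts

map-substT-id : ∀ {n} (ts : Vec Term n) → Vec.map (substT var) ts ≡ ts
map-substT-id [] = refl
map-substT-id (t ∷ ts) = cong₂ _∷_ (substT-id t) (map-substT-id ts)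

substI-ext : ∀ {σ σ'} → σ ≗ σ' → ∀ A → substI σ A ≡ substI σ' A
substI-ext e ⊥f = refl
substI-ext e (atom n k ts) = cong (atom n k) (map-cong (substT-ext e) ts)
substI-ext e (A ⇒ B) = cong₂ _⇒_ (substI-ext e A) (substI-ext e B)
substI-ext e (∀i A) = cong ∀i (substI-ext (liftSub-ext 1 e) A)
substI-ext e (∀p n A) = cong (∀p n) (substI-ext e A)
substI-ext e (μ n A ts) = cong₂ (μ n) (substI-ext (liftSub-ext n e) A) (map-cong (substT-ext e) ts)

substI-∘ : ∀ τ σ A → substI τ (substI σ A) ≡ substI (substT τ ∘ σ) A
substI-∘ τ σ ⊥f = refl
substI-∘ τ σ (atom n k ts) = cong (atom n k) (map-substT-∘ τ σ ts)
substI-∘ τ σ (A ⇒ B) = cong₂ _⇒_ (substI-∘ τ σ A) (substI-∘ τ σ B)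
substI-∘ τ σ (∀i A) = cong ∀i (substI-∘ _ _ A ∙ substI-ext (λ j → sym (liftSub-∘ 1 τ σ j)) A)
substI-∘ τ σ (∀p n A) = cong (∀p n) (substI-∘ τ σ A)
substI-∘ τ σ (μ n A ts) = cong₂ (μ n) (substI-∘ _ _ A ∙ substI-ext (λ j → sym (liftSub-∘ n τ σ j)) A) (map-substT-∘ τ σ ts)

renI≗substI : ∀ f A → renI f A ≡ substI (var ∘ f) A
renI≗substI f ⊥f = refl
renI≗substI f (atom n k ts) = cong (atom n k) (map-cong (renT≗substT f) ts)
renI≗substI f (A ⇒ B) = cong₂ _⇒_ (renI≗substI f A) (renI≗substI f B)
renI≗substI f (∀i A) = cong ∀i (renI≗substI _ A ∙ substI-ext (λ j → sym (liftSub-var 1 f j)) A)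
renI≗substI f (∀p n A) = cong (∀p n) (renI≗substI f A)
renI≗substI f (μ n A ts) = cong₂ (μ n) (renI≗substI _ A ∙ substI-ext (λ j → sym (liftSub-var n f j)) A) (map-cong (renT≗substT f) ts)

substI-id : ∀ A → substI var A ≡ A
substI-id ⊥f = refl
substI-id (atom n k ts) = cong (atom n k) (map-substT-id ts)
substI-id (A ⇒ B) = cong₂ _⇒_ (substI-id A) (substI-id B)
substI-id (∀i A) = cong ∀i (substI-ext (liftSub-id 1) A ∙ substI-id A)
substI-id (∀p n A) = cong (∀p n) (substI-id A)
substI-id (μ n A ts) = cong₂ (μ n) (substI-ext (liftSub-id n) A ∙ substI-id A) (map-substT-id ts)

renI-∘ : ∀ f h A → renI f (renI h A) ≡ renI (f ∘ h) A
renI-∘ f h A = renI≗substI f _ ∙ cong (substI _) (renI≗substI h A) ∙ substI-∘ _ _ A ∙ sym (renI≗substI _ A)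

renI-ext : ∀ {f h} → f ≗ h → ∀ A → renI f A ≡ renI h A
renI-ext e A = renI≗substI _ A ∙ substI-ext (λ i → cong var (e i)) A ∙ sym (renI≗substI _ A)

-- Predicate renaming and individual substitution act on disjoint kinds of
-- variables, so they commute.
renP-substI : ∀ f σ A → renP f (substI σ A) ≡ substI σ (renP f A)
renP-substI f σ ⊥f = refl
renP-substI f σ (atom n k ts) = refl
renP-substI f σ (A ⇒ B) = cong₂ _⇒_ (renP-substI f σ A) (renP-substI f σ B)
renP-substI f σ (∀i A) = cong ∀i (renP-substI f _ A)
renP-substI f σ (∀p n A) = cong (∀p n) (renP-substI _ σ A)
renP-substI f σ (μ n A ts) = cong (λ X → μ n X _) (renP-substI _ _ A)

renP-renI : ∀ f g A → renP f (renI g A) ≡ renI g (renP f A)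
renP-renI f g A = cong (renP f) (renI≗substI g A) ∙ renP-substI f _ A ∙ sym (renI≗substI g _)

liftPR-ext : ∀ m {f g} → (∀ n k → f n k ≡ g n k) → ∀ n k → liftPR m f n k ≡ liftPR m g n k
liftPR-ext m {f} {g} e n k with n ≟ m
... | yes refl = liftPR-eq n f k ∙ liftIdx-ext (e n) k ∙ sym (liftPR-eq n g k)
  where
  liftIdx-ext : ∀ {f g : ℕ → ℕ} → f ≗ g → liftIdx f ≗ liftIdx g
  liftIdx-ext e zero = refl
  liftIdx-ext e (suc k) = cong suc (e k)
... | no ne = liftPR-neq m f n k ne ∙ e n k ∙ sym (liftPR-neq m g n k ne)

renP-ext : ∀ {f g} → (∀ n k → f n k ≡ g n k) → ∀ A → renP f A ≡ renP g A
renP-ext e ⊥f = refl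
renP-ext e (atom n k ts) = cong (λ x → atom n x ts) (e n k)
renP-ext e (A ⇒ B) = cong₂ _⇒_ (renP-ext e A) (renP-ext e B)
renP-ext e (∀i A) = cong ∀i (renP-ext e A)
renP-ext e (∀p m A) = cong (∀p m) (renP-ext (liftPR-ext m e) A)
renP-ext e (μ m A ts) = cong (λ X → μ m X ts) (renP-ext (liftPR-ext m e) A)

liftPR-∘ : ∀ m g f n k → liftPR m g n (liftPR m f n k) ≡ liftPR m (λ n' k' → g n' (f n' k')) n k
liftPR-∘ m g f n k with predIndex m n k
... | bound = cong (liftPR m g m) (liftPR-eq m f zero) ∙ liftPR-eq m g zero ∙ sym (liftPR-eq m (λ n' k' → g n' (f n' k')) zero)
... | outer k = cong (liftPR m g m) (liftPR-eq m f (suc k)) ∙ liftPR-eq m g (suc (f m k)) ∙ sym (liftPR-eq m (λ n' k' → g n' (f n' k')) (suc k))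
... | other k ne = cong (liftPR m g n) (liftPR-neq m f n k ne) ∙ liftPR-neq m g n (f n k) ne ∙ sym (liftPR-neq m (λ n' k' → g n' (f n' k')) n k ne)

renP-∘ : ∀ g f A → renP g (renP f A) ≡ renP (λ n k → g n (f n k)) A
renP-∘ g f ⊥f = refl
renP-∘ g f (atom n k ts) = refl
renP-∘ g f (A ⇒ B) = cong₂ _⇒_ (renP-∘ g f A) (renP-∘ g f B)
renP-∘ g f (∀i A) = cong ∀i (renP-∘ g f A)
renP-∘ g f (∀p m A) = cong (∀p m) (renP-∘ _ _ A ∙ renP-ext (liftPR-∘ m g f) A)
renP-∘ g f (μ m A ts) = cong (λ X → μ m X ts) (renP-∘ _ _ A ∙ renP-ext (liftPR-∘ m g f) A)

liftPR-shift : ∀ m f n k → liftPR m f n (shiftPR m n k) ≡ shiftPR m n (f n k)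
liftPR-shift m f n k with n ≟ m
... | yes refl = cong (liftPR n f n) (shift-eq n k) ∙ liftPR-eq n f (suc k) ∙ sym (shift-eq n (f n k))
... | no ne = cong (liftPR m f n) (shift-neq m n k ne) ∙ liftPR-neq m f n k ne ∙ sym (shift-neq m n (f n k) ne)

renP-liftPR-shift : ∀ m f A → renP (liftPR m f) (renP (shiftPR m) A) ≡ renP (shiftPR m) (renP f A)
renP-liftPR-shift m f A = renP-∘ _ _ A ∙ renP-ext (liftPR-shift m f) A ∙ sym (renP-∘ _ _ A)

infix 4 _≐_
_≐_ : PSub → PSub → Set
ρ ≐ ρ' = ∀ n k → ρ n k ≡ ρ' n k

liftPSI-ext : ∀ j {ρ ρ'} → ρ ≐ ρ' → liftPSI j ρ ≐ liftPSI j ρ'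
liftPSI-ext j e n k = cong (renI _) (e n k)

liftPSP-ext : ∀ m {ρ ρ'} → ρ ≐ ρ' → liftPSP m ρ ≐ liftPSP m ρ'
liftPSP-ext m {ρ} {ρ'} e n k with predIndex m n k
... | bound = liftPSP-eq0 m ρ ∙ sym (liftPSP-eq0 m ρ')
... | outer k = liftPSP-eqS m ρ k ∙ cong (renP _) (e m k) ∙ sym (liftPSP-eqS m ρ' k)
... | other k ne = liftPSP-neq m ρ n k ne ∙ cong (renP _) (e n k) ∙ sym (liftPSP-neq m ρ' n k ne)

substP-ext : ∀ {ρ ρ'} → ρ ≐ ρ' → ∀ A → substP ρ A ≡ substP ρ' A
substP-ext e ⊥f = refl
substP-ext e (atom n k ts) = cong (substI _) (e n k)
substP-ext e (A ⇒ B) = cong₂ _⇒_ (substP-ext e A) (substP-ext e B)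
substP-ext e (∀i A) = cong ∀i (substP-ext (liftPSI-ext 1 e) A)
substP-ext e (∀p m A) = cong (∀p m) (substP-ext (liftPSP-ext m e) A)
substP-ext e (μ m A ts) = cong (λ X → μ m X ts) (substP-ext (liftPSP-ext m (liftPSI-ext m e)) A)

-- σ ⊙ ρ applies the individual substitution σ to the images of ρ (each
-- image has its n parameters bound, hence the lift).
_⊙_ : (ℕ → Term) → PSub → PSub
(σ ⊙ ρ) n k = substI (liftSub n σ) (ρ n k)

liftSub-liftRen : ∀ n j σ i → liftSub n (liftSub j σ) (liftRen n (j +_) i) ≡ renT (liftRen n (j +_)) (liftSub n σ i)
liftSub-liftRen zero j σ i = liftSub-+ j σ i
liftSub-liftRen (suc n) j σ zero = refl
liftSub-liftRen (suc n) j σ (suc i) = cong (renT suc) (liftSub-liftRen n j σ i) ∙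
  renT-∘ suc _ _ ∙ sym (renT-∘ (liftRen (suc n) (j +_)) suc _)

⊙-liftPSI : ∀ j σ ρ → (liftSub j σ) ⊙ (liftPSI j ρ) ≐ liftPSI j (σ ⊙ ρ)
⊙-liftPSI j σ ρ n k =
  cong (substI _) (renI≗substI _ (ρ n k)) ∙ substI-∘ _ _ (ρ n k) ∙
  substI-ext (λ i → liftSub-liftRen n j σ i ∙ renT≗substT _ _) (ρ n k) ∙
  sym (substI-∘ _ _ (ρ n k)) ∙ sym (renI≗substI _ _)

⊙-liftPSP : ∀ m σ ρ → σ ⊙ (liftPSP m ρ) ≐ liftPSP m (σ ⊙ ρ)
⊙-liftPSP m σ ρ n k with predIndex m n k
... | bound = cong (substI _) (liftPSP-eq0 m ρ) ∙
   cong (atom m zero) (map-allVars _ (liftSub-lo m σ)) ∙ sym (liftPSP-eq0 m (σ ⊙ ρ))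
... | outer k = cong (substI _) (liftPSP-eqS m ρ k) ∙
   sym (renP-substI _ _ (ρ m k)) ∙ sym (liftPSP-eqS m (σ ⊙ ρ) k)
... | other k ne = cong (substI _) (liftPSP-neq m ρ n k ne) ∙
   sym (renP-substI _ _ (ρ n k)) ∙ sym (liftPSP-neq m (σ ⊙ ρ) n k ne)

substT-vecEnv : ∀ {n} σ (ts : Vec Term n) j →
  substT σ (vecEnv ts var j) ≡ substT (vecEnv (Vec.map (substT σ) ts) var) (liftSub n σ j)
substT-vecEnv {n} σ ts j with split n j
... | lo i = cong (substT σ) (vecEnv-lo ts var i) ∙
   sym (cong (substT _) (liftSub-lo n σ i) ∙ vecEnv-lo (Vec.map (substT σ) ts) var i ∙ lookup-map i (substT σ) ts)
... | hi p = cong (substT σ) (vecEnv-+ ts var p) ∙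
   sym (cong (substT _) (liftSub-+ n σ p) ∙ substT-renT _ _ (σ p) ∙
        substT-ext (vecEnv-+ (Vec.map (substT σ) ts) var) (σ p) ∙ substT-id (σ p))

substI-vecEnv : ∀ {n} σ (ts : Vec Term n) X →
  substI σ (substI (vecEnv ts var) X) ≡ substI (vecEnv (Vec.map (substT σ) ts) var) (substI (liftSub n σ) X)
substI-vecEnv σ ts X = substI-∘ _ _ X ∙ substI-ext (substT-vecEnv σ ts) X ∙ sym (substI-∘ _ _ X)

substI-substP : ∀ σ ρ A → substI σ (substP ρ A) ≡ substP (σ ⊙ ρ) (substI σ A)
substI-substP σ ρ ⊥f = refl
substI-substP σ ρ (atom n k ts) = substI-vecEnv σ ts (ρ n k)
substI-substP σ ρ (A ⇒ B) = cong₂ _⇒_ (substI-substP σ ρ A) (substI-substP σ ρ B)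
substI-substP σ ρ (∀i A) = cong ∀i (substI-substP _ _ A ∙ substP-ext (⊙-liftPSI 1 σ ρ) (substI (liftSub 1 σ) A))
substI-substP σ ρ (∀p m A) = cong (∀p m) (substI-substP _ _ A ∙ substP-ext (⊙-liftPSP m σ ρ) (substI σ A))
substI-substP σ ρ (μ m A ts) = cong (λ X → μ m X _) (substI-substP _ _ A ∙
   substP-ext (λ n k → ⊙-liftPSP m (liftSub m σ) (liftPSI m ρ) n k ∙ liftPSP-ext m (⊙-liftPSI m σ ρ) n k) (substI (liftSub m σ) A))

renP-liftPSP : ∀ m f ρ → (λ n k → renP (liftPR m f) (liftPSP m ρ n k)) ≐ liftPSP m (λ n k → renP f (ρ n k))
renP-liftPSP m f ρ n k with predIndex m n k
... | bound = cong (renP _) (liftPSP-eq0 m ρ) ∙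
   cong (λ x → atom m x (allVars m)) (liftPR-eq m f zero) ∙ sym (liftPSP-eq0 m (λ n k → renP f (ρ n k)))
... | outer k = cong (renP _) (liftPSP-eqS m ρ k) ∙
   renP-liftPR-shift m f (ρ m k) ∙ sym (liftPSP-eqS m (λ n k → renP f (ρ n k)) k)
... | other k ne = cong (renP _) (liftPSP-neq m ρ n k ne) ∙
   renP-liftPR-shift m f (ρ n k) ∙ sym (liftPSP-neq m (λ n k → renP f (ρ n k)) n k ne)

renP-substP : ∀ f ρ A → renP f (substP ρ A) ≡ substP (λ n k → renP f (ρ n k)) A
renP-substP f ρ ⊥f = refl
renP-substP f ρ (atom n k ts) = renP-substI f _ (ρ n k)
renP-substP f ρ (A ⇒ B) = cong₂ _⇒_ (renP-substP f ρ A) (renP-substP f ρ B)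
renP-substP f ρ (∀i A) = cong ∀i (renP-substP f _ A ∙ substP-ext (λ n k → renP-renI f _ (ρ n k)) A)
renP-substP f ρ (∀p m A) = cong (∀p m) (renP-substP _ _ A ∙ substP-ext (renP-liftPSP m f ρ) A)
renP-substP f ρ (μ m A ts) = cong (λ X → μ m X ts) (renP-substP _ _ A ∙
   substP-ext (λ n k → renP-liftPSP m f (liftPSI m ρ) n k ∙ liftPSP-ext m (λ n' k' → renP-renI f _ (ρ n' k')) n k) A)

liftPSP-liftPR : ∀ m ρ f → (λ n k → liftPSP m ρ n (liftPR m f n k)) ≐ liftPSP m (λ n k → ρ n (f n k))
liftPSP-liftPR m ρ f n k with predIndex m n k
... | bound = cong (liftPSP m ρ m) (liftPR-eq m f zero) ∙
   liftPSP-eq0 m ρ ∙ sym (liftPSP-eq0 m (λ n k → ρ n (f n k)))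
... | outer k = cong (liftPSP m ρ m) (liftPR-eq m f (suc k)) ∙
   liftPSP-eqS m ρ (f m k) ∙ sym (liftPSP-eqS m (λ n k → ρ n (f n k)) k)
... | other k ne = cong (liftPSP m ρ n) (liftPR-neq m f n k ne) ∙
   liftPSP-neq m ρ n (f n k) ne ∙ sym (liftPSP-neq m (λ n k → ρ n (f n k)) n k ne)

substP-renP : ∀ ρ f A → substP ρ (renP f A) ≡ substP (λ n k → ρ n (f n k)) A
substP-renP ρ f ⊥f = refl
substP-renP ρ f (atom n k ts) = refl
substP-renP ρ f (A ⇒ B) = cong₂ _⇒_ (substP-renP ρ f A) (substP-renP ρ f B)
substP-renP ρ f (∀i A) = cong ∀i (substP-renP _ f A)
substP-renP ρ f (∀p m A) = cong (∀p m) (substP-renP _ _ A ∙ substP-ext (liftPSP-liftPR m ρ f) A)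
substP-renP ρ f (μ m A ts) = cong (λ X → μ m X ts) (substP-renP _ _ A ∙ substP-ext (liftPSP-liftPR m (liftPSI m ρ) f) A)

liftPSP-shift : ∀ m ρ p j → liftPSP m ρ p (shiftPR m p j) ≡ renP (shiftPR m) (ρ p j)
liftPSP-shift m ρ p j with p ≟ m
... | yes refl = cong (liftPSP p ρ p) (shift-eq p j) ∙ liftPSP-eqS p ρ j
... | no ne = cong (liftPSP m ρ p) (shift-neq m p j ne) ∙ liftPSP-neq m ρ p j ne

-- Composition of predicate substitutions: τ ⊛ ρ substitutes ρ into the
-- images of τ, so that A[τ][ρ] = A[τ ⊛ ρ] (`substP-∘`).
_⊛_ : PSub → PSub → PSub
(τ ⊛ ρ) n k = substP (liftPSI n ρ) (τ n k)

-- The arguments of an atom cancel the weakening that liftPSI applied to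
-- the parameters of the substituted formula.
vecEnv-cancels-wk : ∀ {n} (ts : Vec Term n) p i → liftSub p (vecEnv ts var) (liftRen p (n +_) i) ≡ var i
vecEnv-cancels-wk {n} ts p i with split p i
... | lo i' = cong (liftSub p _) (liftRen-lo p (n +_) i') ∙ liftSub-lo p _ i'
... | hi q = cong (liftSub p _) (liftRen-+ p (n +_) q) ∙ liftSub-+ p _ (n + q) ∙ cong (renT (p +_)) (vecEnv-+ ts var q)

vecEnv-⊙-liftPSI : ∀ {n} (ts : Vec Term n) ρ → (vecEnv ts var) ⊙ (liftPSI n ρ) ≐ ρ
vecEnv-⊙-liftPSI ts ρ p k = cong (substI _) (renI≗substI _ (ρ p k)) ∙ substI-∘ _ _ (ρ p k) ∙
   substI-ext (vecEnv-cancels-wk ts p) (ρ p k) ∙ substI-id (ρ p k)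

-- Weakenings past different numbers of binders commute; this lifts ⊛ past ∀x.
liftRen-comm : ∀ p n j i → liftRen p (liftRen n (j +_)) (liftRen p (n +_) i) ≡ liftRen p (n +_) (liftRen p (j +_) i)
liftRen-comm p n j i with split p i
... | lo i' = cong (liftRen p _) (liftRen-lo p _ i') ∙ liftRen-lo p _ i' ∙
    sym (cong (liftRen p _) (liftRen-lo p _ i') ∙ liftRen-lo p _ i')
... | hi q = cong (liftRen p _) (liftRen-+ p (n +_) q) ∙ liftRen-+ p _ (n + q) ∙
    cong (p +_) (liftRen-+ n (j +_) q) ∙ sym (cong (liftRen p (n +_)) (liftRen-+ p (j +_) q) ∙ liftRen-+ p (n +_) (j + q))

liftPSI-⊛ : ∀ j τ ρ → (liftPSI j τ) ⊛ (liftPSI j ρ) ≐ liftPSI j (τ ⊛ ρ)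
liftPSI-⊛ j τ ρ n k = sym (renI≗substI _ _ ∙ substI-substP _ _ (τ n k) ∙
   substP-ext paramShift (substI _ (τ n k)) ∙ cong (substP _) (sym (renI≗substI _ (τ n k))))
  where
  paramShift : (var ∘ liftRen n (j +_)) ⊙ (liftPSI n ρ) ≐ liftPSI n (liftPSI j ρ)
  paramShift p i = cong (substI _) (renI≗substI _ (ρ p i)) ∙ substI-∘ _ _ (ρ p i) ∙
     substI-ext (λ x → liftSub-var p _ _ ∙ cong var (liftRen-comm p n j x)) (ρ p i) ∙
     sym (renI≗substI _ _ ∙ cong (substI _) (renI≗substI _ (ρ p i)) ∙ substI-∘ _ _ (ρ p i))

-- A formula shifted past an m-ary binder only meets the outer part of a
-- lifted substitution.
substP-liftPSP-shift : ∀ j m ρ X → substP (liftPSI j (liftPSP m ρ)) (renP (shiftPR m) X) ≡ renP (shiftPR m) (substP (liftPSI j ρ) X)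
substP-liftPSP-shift j m ρ X = substP-renP _ _ X ∙
  substP-ext (λ p i → cong (renI _) (liftPSP-shift m ρ p i) ∙ sym (renP-renI _ _ (ρ p i))) X ∙ sym (renP-substP _ _ X)

liftPSP-⊛ : ∀ m τ ρ → (liftPSP m τ) ⊛ (liftPSP m ρ) ≐ liftPSP m (τ ⊛ ρ)
liftPSP-⊛ m τ ρ n k with predIndex m n k
... | bound = cong (substP _) (liftPSP-eq0 m τ) ∙
  cong (λ X → substI (vecEnv (allVars m) var) (renI (liftRen m (m +_)) X)) (liftPSP-eq0 m ρ) ∙
  cong (λ v → substI (vecEnv (allVars m) var) (atom m zero v)) (map-allVars-ren _ (liftRen-lo m (m +_))) ∙
  cong (atom m zero) (map-allVars-env (allVars m) var) ∙ sym (liftPSP-eq0 m (τ ⊛ ρ))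
... | outer k = cong (substP _) (liftPSP-eqS m τ k) ∙
  substP-liftPSP-shift m m ρ (τ m k) ∙ sym (liftPSP-eqS m (τ ⊛ ρ) k)
... | other k ne = cong (substP _) (liftPSP-neq m τ n k ne) ∙
  substP-liftPSP-shift n m ρ (τ n k) ∙ sym (liftPSP-neq m (τ ⊛ ρ) n k ne)

substP-∘ : ∀ ρ τ A → substP ρ (substP τ A) ≡ substP (τ ⊛ ρ) A
substP-∘ ρ τ ⊥f = refl
substP-∘ ρ τ (atom n k ts) = sym (substI-substP _ _ (τ n k) ∙ substP-ext (vecEnv-⊙-liftPSI ts ρ) (substI (vecEnv ts var) (τ n k)))
substP-∘ ρ τ (A ⇒ B) = cong₂ _⇒_ (substP-∘ ρ τ A) (substP-∘ ρ τ B)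
substP-∘ ρ τ (∀i A) = cong ∀i (substP-∘ _ _ A ∙ substP-ext (liftPSI-⊛ 1 τ ρ) A)
substP-∘ ρ τ (∀p m A) = cong (∀p m) (substP-∘ _ _ A ∙ substP-ext (liftPSP-⊛ m τ ρ) A)
substP-∘ ρ τ (μ m A ts) = cong (λ X → μ m X ts) (substP-∘ _ _ A ∙
  substP-ext (λ n k → liftPSP-⊛ m (liftPSI m τ) (liftPSI m ρ) n k ∙ liftPSP-ext m (liftPSI-⊛ m τ ρ) n k) A)

idPSub : PSub
idPSub n k = atom n k (allVars n)

liftPSI-id : ∀ j → liftPSI j idPSub ≐ idPSub
liftPSI-id j n k = cong (atom n k) (map-allVars-ren _ (liftRen-lo n (j +_)))

liftPSP-id : ∀ m → liftPSP m idPSub ≐ idPSub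
liftPSP-id m n k with predIndex m n k
... | bound = liftPSP-eq0 m idPSub
... | outer k = liftPSP-eqS m idPSub k ∙ cong (λ x → atom m x (allVars m)) (shift-eq m k)
... | other k ne = liftPSP-neq m idPSub n k ne ∙ cong (λ x → atom n x (allVars n)) (shift-neq m n k ne)

substP-id : ∀ {ρ} → ρ ≐ idPSub → ∀ A → substP ρ A ≡ A
substP-id e ⊥f = refl
substP-id e (atom n k ts) = cong (substI _) (e n k) ∙ cong (atom n k) (map-allVars-env ts var)
substP-id e (A ⇒ B) = cong₂ _⇒_ (substP-id e A) (substP-id e B)
substP-id e (∀i A) = cong ∀i (substP-id (λ n k → cong (renI _) (e n k) ∙ liftPSI-id 1 n k) A)
substP-id e (∀p m A) = cong (∀p m) (substP-id (λ n k → liftPSP-ext m e n k ∙ liftPSP-id m n k) A)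
substP-id e (μ m A ts) = cong (λ X → μ m X ts)
  (substP-id (λ n k → liftPSP-ext m (λ n' k' → cong (renI _) (e n' k') ∙ liftPSI-id m n' k') n k ∙ liftPSP-id m n k) A)

-- Invariance of occurrence, polarity and well-formedness.  Individual
-- substitutions do not touch predicate variables, so they preserve all
-- three.

occurs-substI : ∀ σ n k A → Occurs n k A → Occurs n k (substI σ A)
occurs-substI σ n k (atom m j ts) o = o
occurs-substI σ n k (A ⇒ B) (inj₁ o) = inj₁ (occurs-substI σ n k A o)
occurs-substI σ n k (A ⇒ B) (inj₂ o) = inj₂ (occurs-substI σ n k B o)
occurs-substI σ n k (∀i A) o = occurs-substI _ n k A o
occurs-substI σ n k (∀p m A) o = occurs-substI σ n _ A o
occurs-substI σ n k (μ m A ts) o = occurs-substI _ n _ A o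

mutual
  pos-substI : ∀ σ n k A → Pos n k A → Pos n k (substI σ A)
  pos-substI σ n k ⊥f p = tt
  pos-substI σ n k (atom m j ts) p = tt
  pos-substI σ n k (A ⇒ B) (p , q) = neg-substI σ n k A p , pos-substI σ n k B q
  pos-substI σ n k (∀i A) p = pos-substI _ n k A p
  pos-substI σ n k (∀p m A) p = pos-substI σ n _ A p
  pos-substI σ n k (μ m A ts) p = pos-substI _ n _ A p

  neg-substI : ∀ σ n k A → Neg n k A → Neg n k (substI σ A)
  neg-substI σ n k ⊥f p = tt
  neg-substI σ n k (atom m j ts) p = p
  neg-substI σ n k (A ⇒ B) (p , q) = pos-substI σ n k A p , neg-substI σ n k B q
  neg-substI σ n k (∀i A) p = neg-substI _ n k A p
  neg-substI σ n k (∀p m A) p = neg-substI σ n _ A p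
  neg-substI σ n k (μ m A ts) p = neg-substI _ n _ A p

wf-substI : ∀ σ A → WF A → WF (substI σ A)
wf-substI σ ⊥f w = tt
wf-substI σ (atom n k ts) w = tt
wf-substI σ (A ⇒ B) (w , v) = wf-substI σ A w , wf-substI σ B v
wf-substI σ (∀i A) w = wf-substI _ A w
wf-substI σ (∀p n A) w = wf-substI σ A w
wf-substI σ (μ n A ts) (o , p , w) = occurs-substI _ n zero A o , pos-substI _ n zero A p , wf-substI _ A w

occurs-renI : ∀ f n k A → Occurs n k A → Occurs n k (renI f A)
occurs-renI f n k A o = subst (Occurs n k) (sym (renI≗substI f A)) (occurs-substI _ n k A o)

pos-renI : ∀ f n k A → Pos n k A → Pos n k (renI f A)
pos-renI f n k A o = subst (Pos n k) (sym (renI≗substI f A)) (pos-substI _ n k A o)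

neg-renI : ∀ f n k A → Neg n k A → Neg n k (renI f A)
neg-renI f n k A o = subst (Neg n k) (sym (renI≗substI f A)) (neg-substI _ n k A o)

wf-renI : ∀ f A → WF A → WF (renI f A)
wf-renI f A w = subst WF (sym (renI≗substI f A)) (wf-substI _ A w)

occurs-renP : ∀ f n k k' A → f n k ≡ k' → Occurs n k A → Occurs n k' (renP f A)
occurs-renP f n k k' (atom m j ts) e (refl , refl) = refl , e
occurs-renP f n k k' (A ⇒ B) e (inj₁ o) = inj₁ (occurs-renP f n k k' A e o)
occurs-renP f n k k' (A ⇒ B) e (inj₂ o) = inj₂ (occurs-renP f n k k' B e o)
occurs-renP f n k k' (∀i A) e o = occurs-renP f n k k' A e o
occurs-renP f n k k' (∀p m A) e o = occurs-renP _ n _ _ A (liftPR-shift m f n k ∙ cong (shiftPR m n) e) o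
occurs-renP f n k k' (μ m A ts) e o = occurs-renP _ n _ _ A (liftPR-shift m f n k ∙ cong (shiftPR m n) e) o

InjectiveAt : (ℕ → ℕ → ℕ) → ℕ → ℕ → ℕ → Set
InjectiveAt f n k k' = ∀ j → f n j ≡ k' → j ≡ k

InjectiveAt-lift : ∀ m f n k k' → InjectiveAt f n k k' → InjectiveAt (liftPR m f) n (shiftPR m n k) (shiftPR m n k')
InjectiveAt-lift m f n k k' inj j e with predIndex m n j
... | bound with sym (liftPR-eq m f zero) ∙ e ∙ shift-eq m k'
...   | ()
InjectiveAt-lift m f n k k' inj j e | outer j' =
  cong suc (inj j' (suc-injective (sym (liftPR-eq m f (suc j')) ∙ e ∙ shift-eq m k'))) ∙ sym (shift-eq m k)
InjectiveAt-lift m f n k k' inj j e | other j' ne =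
  inj j' (sym (liftPR-neq m f n j' ne) ∙ e ∙ shift-neq m n k' ne) ∙ sym (shift-neq m n k ne)

mutual
  pos-renP : ∀ f n k k' A → InjectiveAt f n k k' → Pos n k A → Pos n k' (renP f A)
  pos-renP f n k k' ⊥f i p = tt
  pos-renP f n k k' (atom m j ts) i p = tt
  pos-renP f n k k' (A ⇒ B) i (p , q) = neg-renP f n k k' A i p , pos-renP f n k k' B i q
  pos-renP f n k k' (∀i A) i p = pos-renP f n k k' A i p
  pos-renP f n k k' (∀p m A) i p = pos-renP _ n _ _ A (InjectiveAt-lift m f n k k' i) p
  pos-renP f n k k' (μ m A ts) i p = pos-renP _ n _ _ A (InjectiveAt-lift m f n k k' i) p

  neg-renP : ∀ f n k k' A → InjectiveAt f n k k' → Neg n k A → Neg n k' (renP f A)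
  neg-renP f n k k' ⊥f i p = tt
  neg-renP f n k k' (atom m j ts) i p (refl , e) = p (refl , i j e)
  neg-renP f n k k' (A ⇒ B) i (p , q) = pos-renP f n k k' A i p , neg-renP f n k k' B i q
  neg-renP f n k k' (∀i A) i p = neg-renP f n k k' A i p
  neg-renP f n k k' (∀p m A) i p = neg-renP _ n _ _ A (InjectiveAt-lift m f n k k' i) p
  neg-renP f n k k' (μ m A ts) i p = neg-renP _ n _ _ A (InjectiveAt-lift m f n k k' i) p

-- No n-ary index is sent to k' by f: then k' does not occur in the
-- renamed formula and so is both positive and negative there.
Avoids : (ℕ → ℕ → ℕ) → ℕ → ℕ → Set
Avoids f n k' = ∀ j → ¬ (f n j ≡ k')

Avoids-lift : ∀ m f n k' → Avoids f n k' → Avoids (liftPR m f) n (shiftPR m n k')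
Avoids-lift m f n k' fr j e with predIndex m n j
... | bound with sym (liftPR-eq m f zero) ∙ e ∙ shift-eq m k'
...   | ()
Avoids-lift m f n k' fr j e | outer j' = fr j' (suc-injective (sym (liftPR-eq m f (suc j')) ∙ e ∙ shift-eq m k'))
Avoids-lift m f n k' fr j e | other j' ne = fr j' (sym (liftPR-neq m f n j' ne) ∙ e ∙ shift-neq m n k' ne)

avoided-renP : ∀ f n k' A → Avoids f n k' → Pos n k' (renP f A) × Neg n k' (renP f A)
avoided-renP f n k' ⊥f fr = tt , tt
avoided-renP f n k' (atom m j ts) fr = tt , λ { (refl , e) → fr j e }
avoided-renP f n k' (A ⇒ B) fr = (proj₂ (avoided-renP f n k' A fr) , proj₁ (avoided-renP f n k' B fr)) ,
   (proj₁ (avoided-renP f n k' A fr) , proj₂ (avoided-renP f n k' B fr))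
avoided-renP f n k' (∀i A) fr = avoided-renP f n k' A fr
avoided-renP f n k' (∀p m A) fr = avoided-renP _ n _ A (Avoids-lift m f n k' fr)
avoided-renP f n k' (μ m A ts) fr = avoided-renP _ n _ A (Avoids-lift m f n k' fr)

shiftPR-injectiveAt : ∀ p n k' → InjectiveAt (shiftPR p) n k' (shiftPR p n k')
shiftPR-injectiveAt p n k' j e with n ≟ p
... | yes refl = suc-injective (sym (shift-eq n j) ∙ e ∙ shift-eq n k')
... | no ne = sym (shift-neq p n j ne) ∙ e ∙ shift-neq p n k' ne

shiftPR-avoids-bound : ∀ m → Avoids (shiftPR m) m zero
shiftPR-avoids-bound m j e with sym (shift-eq m j) ∙ e
... | ()

liftPR-injectiveAt-bound : ∀ m f → InjectiveAt (liftPR m f) m zero zero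
liftPR-injectiveAt-bound m f zero e = refl
liftPR-injectiveAt-bound m f (suc j) e with sym (liftPR-eq m f (suc j)) ∙ e
... | ()

wf-renP : ∀ f A → WF A → WF (renP f A)
wf-renP f ⊥f w = tt
wf-renP f (atom n k ts) w = tt
wf-renP f (A ⇒ B) (w , v) = wf-renP f A w , wf-renP f B v
wf-renP f (∀i A) w = wf-renP f A w
wf-renP f (∀p n A) w = wf-renP _ A w
wf-renP f (μ n A ts) (o , p , w) =
  occurs-renP _ n zero zero A (liftPR-eq n f zero) o ,
  pos-renP _ n zero zero A (liftPR-injectiveAt-bound n f) p ,
  wf-renP _ A w

-- Predicate substitution.  An occurrence of k survives when ρ k contains
-- k'; positivity transfers from k to k' when ρ k is positive in k' and no
-- other image mentions k' (`PositiveAt`).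

occurs-substP : ∀ ρ n k k' A → Occurs n k' (ρ n k) → Occurs n k A → Occurs n k' (substP ρ A)
occurs-substP ρ n k k' (atom m j ts) h (refl , refl) = occurs-substI _ n k' (ρ n k) h
occurs-substP ρ n k k' (A ⇒ B) h (inj₁ o) = inj₁ (occurs-substP ρ n k k' A h o)
occurs-substP ρ n k k' (A ⇒ B) h (inj₂ o) = inj₂ (occurs-substP ρ n k k' B h o)
occurs-substP ρ n k k' (∀i A) h o = occurs-substP _ n k k' A (occurs-renI _ n k' (ρ n k) h) o
occurs-substP ρ n k k' (∀p m A) h o = occurs-substP _ n _ _ A
  (subst (Occurs n (shiftPR m n k')) (sym (liftPSP-shift m ρ n k)) (occurs-renP _ n k' _ (ρ n k) refl h)) o
occurs-substP ρ n k k' (μ m A ts) h o = occurs-substP _ n _ _ A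
  (subst (Occurs n (shiftPR m n k')) (sym (liftPSP-shift m (liftPSI m ρ) n k))
    (occurs-renP (shiftPR m) n k' _ (liftPSI m ρ n k) refl (occurs-renI _ n k' (ρ n k) h))) o

-- Both polarities of k' in X (k' has no occurrence in X).
Absent : ℕ → ℕ → Formula → Set
Absent n k' X = Pos n k' X × Neg n k' X

PositiveAt : PSub → ℕ → ℕ → ℕ → Set
PositiveAt ρ n k k' = Pos n k' (ρ n k) × (∀ n' j → ¬ (n' ≡ n × j ≡ k) → Absent n k' (ρ n' j))

PositiveAt-liftPSI : ∀ i ρ n k k' → PositiveAt ρ n k k' → PositiveAt (liftPSI i ρ) n k k'
PositiveAt-liftPSI i ρ n k k' (a , b) = pos-renI _ n k' (ρ n k) a ,
  λ n' j ne → pos-renI _ n k' (ρ n' j) (proj₁ (b n' j ne)) , neg-renI _ n k' (ρ n' j) (proj₂ (b n' j ne))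

PositiveAt-liftPSP : ∀ p ρ n k k' → PositiveAt ρ n k k' → PositiveAt (liftPSP p ρ) n (shiftPR p n k) (shiftPR p n k')
PositiveAt-liftPSP p ρ n k k' (a , b) =
  subst (Pos n (shiftPR p n k')) (sym (liftPSP-shift p ρ n k)) (pos-renP _ n k' _ (ρ n k) (shiftPR-injectiveAt p n k') a) ,
  others
  where
  shifted : ∀ X → Absent n k' X → Absent n (shiftPR p n k') (renP (shiftPR p) X)
  shifted X (u , v) = pos-renP _ n k' _ X (shiftPR-injectiveAt p n k') u , neg-renP _ n k' _ X (shiftPR-injectiveAt p n k') v
  others : ∀ n' j → ¬ (n' ≡ n × j ≡ shiftPR p n k) → Absent n (shiftPR p n k') (liftPSP p ρ n' j)
  others n' j nh with predIndex p n' j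
  ... | bound = subst (Absent n (shiftPR p n k')) (sym (liftPSP-eq0 p ρ))
     (tt , λ { (refl , e) → zero≢suc (e ∙ shift-eq p k') })
    where
    zero≢suc : ∀ {x} → ¬ zero ≡ suc x
    zero≢suc ()
  ... | outer j' = subst (Absent n (shiftPR p n k')) (sym (liftPSP-eqS p ρ j'))
     (shifted (ρ p j') (b p j' λ { (refl , refl) → nh (refl , sym (shift-eq p k)) }))
  ... | other j' ne = subst (Absent n (shiftPR p n k')) (sym (liftPSP-neq p ρ n' j' ne))
     (shifted (ρ n' j') (b n' j' λ { (refl , refl) → nh (refl , sym (shift-neq p n' k ne)) }))

-- After an m-ary binder the bound predicate (index 0) is positive-at
-- itself: its image is the atom, and all other images are shifted.
PositiveAt-bound : ∀ m ρ → PositiveAt (liftPSP m ρ) m zero zero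
PositiveAt-bound m ρ = subst (Pos m zero) (sym (liftPSP-eq0 m ρ)) tt , others
  where
  others : ∀ n' j → ¬ (n' ≡ m × j ≡ zero) → Absent m zero (liftPSP m ρ n' j)
  others n' j nh with predIndex m n' j
  ... | bound = ⊥-elim (nh (refl , refl))
  ... | outer j' = subst (Absent m zero) (sym (liftPSP-eqS m ρ j'))
     (avoided-renP _ m zero (ρ m j') (shiftPR-avoids-bound m))
  ... | other j' ne = subst (Absent m zero) (sym (liftPSP-neq m ρ n' j' ne))
     (avoided-renP _ m zero (ρ n' j') (shiftPR-avoids-bound m))

mutual
  pos-substP : ∀ ρ n k k' A → PositiveAt ρ n k k' → Pos n k A → Pos n k' (substP ρ A)
  pos-substP ρ n k k' ⊥f pc p = tt
  pos-substP ρ n k k' (atom m j ts) pc p with m ≟ n | j ≟ k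
  ... | yes refl | yes refl = pos-substI _ n k' (ρ n k) (proj₁ pc)
  ... | yes refl | no ne = pos-substI _ n k' (ρ m j) (proj₁ (proj₂ pc m j λ { (_ , e) → ne e }))
  ... | no ne | _ = pos-substI _ n k' (ρ m j) (proj₁ (proj₂ pc m j λ { (e , _) → ne e }))
  pos-substP ρ n k k' (A ⇒ B) pc (p , q) = neg-substP ρ n k k' A pc p , pos-substP ρ n k k' B pc q
  pos-substP ρ n k k' (∀i A) pc p = pos-substP _ n k k' A (PositiveAt-liftPSI 1 ρ n k k' pc) p
  pos-substP ρ n k k' (∀p m A) pc p = pos-substP _ n _ _ A (PositiveAt-liftPSP m ρ n k k' pc) p
  pos-substP ρ n k k' (μ m A ts) pc p = pos-substP _ n _ _ A (PositiveAt-liftPSP m _ n k k' (PositiveAt-liftPSI m ρ n k k' pc)) p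

  neg-substP : ∀ ρ n k k' A → PositiveAt ρ n k k' → Neg n k A → Neg n k' (substP ρ A)
  neg-substP ρ n k k' ⊥f pc p = tt
  neg-substP ρ n k k' (atom m j ts) pc p = neg-substI _ n k' (ρ m j) (proj₂ (proj₂ pc m j p))
  neg-substP ρ n k k' (A ⇒ B) pc (p , q) = pos-substP ρ n k k' A pc p , neg-substP ρ n k k' B pc q
  neg-substP ρ n k k' (∀i A) pc p = neg-substP _ n k k' A (PositiveAt-liftPSI 1 ρ n k k' pc) p
  neg-substP ρ n k k' (∀p m A) pc p = neg-substP _ n _ _ A (PositiveAt-liftPSP m ρ n k k' pc) p
  neg-substP ρ n k k' (μ m A ts) pc p = neg-substP _ n _ _ A (PositiveAt-liftPSP m _ n k k' (PositiveAt-liftPSI m ρ n k k' pc)) p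

WFSub : PSub → Set
WFSub ρ = ∀ n k → WF (ρ n k)

wfSub-liftPSI : ∀ i ρ → WFSub ρ → WFSub (liftPSI i ρ)
wfSub-liftPSI i ρ w n k = wf-renI _ (ρ n k) (w n k)

wfSub-liftPSP : ∀ m ρ → WFSub ρ → WFSub (liftPSP m ρ)
wfSub-liftPSP m ρ w n k with predIndex m n k
... | bound = subst WF (sym (liftPSP-eq0 m ρ)) tt
... | outer k = subst WF (sym (liftPSP-eqS m ρ k)) (wf-renP _ (ρ m k) (w m k))
... | other k ne = subst WF (sym (liftPSP-neq m ρ n k ne)) (wf-renP _ (ρ n k) (w n k))

wf-substP : ∀ ρ A → WFSub ρ → WF A → WF (substP ρ A)
wf-substP ρ ⊥f wr w = tt
wf-substP ρ (atom n k ts) wr w = wf-substI _ (ρ n k) (wr n k)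
wf-substP ρ (A ⇒ B) wr (w , v) = wf-substP ρ A wr w , wf-substP ρ B wr v
wf-substP ρ (∀i A) wr w = wf-substP _ A (wfSub-liftPSI 1 ρ wr) w
wf-substP ρ (∀p m A) wr w = wf-substP _ A (wfSub-liftPSP m ρ wr) w
wf-substP ρ (μ m A ts) wr (o , p , w) =
  occurs-substP _ m zero zero A (subst (Occurs m zero) (sym (liftPSP-eq0 m (liftPSI m ρ))) (refl , refl)) o ,
  pos-substP _ m zero zero A (PositiveAt-bound m (liftPSI m ρ)) p ,
  wf-substP _ A (wfSub-liftPSP m _ (wfSub-liftPSI m ρ wr)) w

wfSub-inst1 : ∀ n G → WF G → WFSub (inst1 n G)
wfSub-inst1 n G w m k with predIndex n m k
... | bound = subst WF (sym (inst1-eq0 n G)) w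
... | outer k = subst WF (sym (inst1-eqS n G k)) tt
... | other k ne = subst WF (sym (inst1-neq n G m k ne)) tt

substI-inst1I : ∀ σ t A → substI σ (inst1I t A) ≡ inst1I (substT σ t) (substI (liftSub 1 σ) A)
substI-inst1I σ t A = substI-∘ _ _ A ∙ substI-ext pt A ∙ sym (substI-∘ _ _ A)
  where
  pt : ∀ j → substT σ (vecEnv (t ∷ []) var j) ≡ substT (vecEnv (substT σ t ∷ []) var) (liftSub 1 σ j)
  pt zero = refl
  pt (suc j) = sym (substT-renT _ suc (σ j) ∙ substT-id (σ j))

renI-suc-substI : ∀ σ A → renI suc (substI σ A) ≡ substI (liftSub 1 σ) (renI suc A)
renI-suc-substI σ A = renI≗substI suc _ ∙ substI-∘ _ _ A ∙ substI-ext (λ j → sym (renT≗substT suc (σ j))) A ∙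
  sym (cong (substI _) (renI≗substI suc A) ∙ substI-∘ _ _ A)

inst1-⊙ : ∀ n G σ → σ ⊙ inst1 n G ≐ inst1 n (substI (liftSub n σ) G)
inst1-⊙ n G σ m k with predIndex n m k
... | bound = cong (substI _) (inst1-eq0 n G) ∙ sym (inst1-eq0 n _)
... | outer k = cong (substI _) (inst1-eqS n G k) ∙
   cong (atom n k) (map-allVars _ (liftSub-lo n σ)) ∙ sym (inst1-eqS n (substI (liftSub n σ) G) k)
... | other k ne = cong (substI _) (inst1-neq n G m k ne) ∙
   cong (atom m k) (map-allVars _ (liftSub-lo m σ)) ∙ sym (inst1-neq n (substI (liftSub n σ) G) m k ne)

substI-substP1 : ∀ σ n G A → substI σ (substP1 n G A) ≡ substP1 n (substI (liftSub n σ) G) (substI σ A)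
substI-substP1 σ n G A = substI-substP σ _ A ∙ substP-ext (inst1-⊙ n G σ) (substI σ A)

substI-wkParams : ∀ m τ Y → substI (liftSub m (liftSub m τ)) (wkParams m Y) ≡ wkParams m (substI (liftSub m τ) Y)
substI-wkParams m τ Y = cong (substI _) (renI≗substI _ Y) ∙ substI-∘ _ _ Y ∙
  substI-ext (λ i → liftSub-liftRen m m τ i ∙ renT≗substT _ _) Y ∙
  sym (renI≗substI _ _ ∙ substI-∘ _ _ Y)

substI-μParam : ∀ m σ D → substI (liftSub m σ) (μParam m D) ≡ μParam m (substI (liftSub m σ) D)
substI-μParam m σ D = cong₂ (μ m) (substI-wkParams m σ D) (map-allVars _ (liftSub-lo m σ))

substI-unfold : ∀ σ m D ts → substI σ (unfold m D ts) ≡ unfold m (substI (liftSub m σ) D) (Vec.map (substT σ) ts)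
substI-unfold σ m D ts = substI-vecEnv σ ts _ ∙ cong (substI _) (substI-substP1 (liftSub m σ) m _ D ∙
  cong (λ G → substP1 m G (substI (liftSub m σ) D)) (substI-wkParams m σ (μParam m D) ∙ cong (wkParams m) (substI-μParam m σ D)))

particular-substT : ∀ E σ u w → Particular E u w → Particular E (substT σ u) (substT σ w)
particular-substT E σ u w (σ₀ , l , r , el , inj₁ (refl , refl)) = substT σ ∘ σ₀ , l , r , el , inj₁ (substT-∘ σ σ₀ l , substT-∘ σ σ₀ r)
particular-substT E σ u w (σ₀ , l , r , el , inj₂ (refl , refl)) = substT σ ∘ σ₀ , l , r , el , inj₂ (substT-∘ σ σ₀ r , substT-∘ σ σ₀ l)

renP-inst1 : ∀ f n G → (λ m k → renP f (inst1 n G m k)) ≐ (λ m k → inst1 n (renP f G) m (liftPR n f m k))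
renP-inst1 f n G m k with predIndex n m k
... | bound = cong (renP f) (inst1-eq0 n G) ∙
   sym (cong (inst1 n (renP f G) n) (liftPR-eq n f zero) ∙ inst1-eq0 n (renP f G))
... | outer k = cong (renP f) (inst1-eqS n G k) ∙
   sym (cong (inst1 n (renP f G) n) (liftPR-eq n f (suc k)) ∙ inst1-eqS n (renP f G) (f n k))
... | other k ne = cong (renP f) (inst1-neq n G m k ne) ∙
   sym (cong (inst1 n (renP f G) m) (liftPR-neq n f m k ne) ∙ inst1-neq n (renP f G) m (f m k) ne)

renP-substP1 : ∀ f n G A → renP f (substP1 n G A) ≡ substP1 n (renP f G) (renP (liftPR n f) A)
renP-substP1 f n G A = renP-substP f _ A ∙ substP-ext (renP-inst1 f n G) A ∙ sym (substP-renP _ _ A)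

renP-unfold : ∀ f m D ts → renP f (unfold m D ts) ≡ unfold m (renP (liftPR m f) D) ts
renP-unfold f m D ts = renP-substI f _ _ ∙ cong (substI _) (renP-substP1 f m _ D ∙
  cong (λ G → substP1 m G (renP (liftPR m f) D)) (renP-renI f _ _ ∙ cong (λ X → wkParams m (μ m X (allVars m))) (renP-renI _ _ D)))

-- ⊆ is closed under individual substitution and under predicate renaming;
-- the derivation is transformed rule by rule, and uses (μ'_g) only where
-- the given one does.

cast : ∀ {E g A A' B B'} → A ≡ A' → B ≡ B' → Incl E g A B → Incl E g A' B'
cast refl refl d = d

incl-substI : ∀ {E g A B} σ → Incl E g A B → Incl E g (substI σ A) (substI σ B)
incl-substI σ (ax {A} w) = ax (wf-substI σ A w)
incl-substI σ (arr d d') = arr (incl-substI σ d) (incl-substI σ d')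
incl-substI σ (alliL {A} t d) = alliL (substT σ t) (cast (substI-inst1I σ t A) refl (incl-substI σ d))
incl-substI σ (alliR {A} d) = alliR (cast (sym (renI-suc-substI σ A)) refl (incl-substI (liftSub 1 σ) d))
incl-substI σ (allpL {n} {A} G w d) =
  allpL (substI (liftSub n σ) G) (wf-substI _ G w) (cast (substI-substP1 σ n G A) refl (incl-substI σ d))
incl-substI σ (allpR {n} {A} d) = allpR (cast (sym (renP-substI (shiftPR n) σ A)) refl (incl-substI σ d))
incl-substI σ (eqn {A} {B} {u} {w} p d) =
  cast refl (sym (substI-inst1I σ w B)) (eqn (particular-substT _ σ u w p) (cast refl (substI-inst1I σ u B) (incl-substI σ d)))
incl-substI σ (trans d d') = trans (incl-substI σ d) (incl-substI σ d')
incl-substI σ (μd {m} {D} {ts} w) = cast (sym (substI-unfold σ m D ts)) refl (μd (wf-substI σ (μ m D ts) w))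
incl-substI σ (μg' {m} {D} {ts} t w) = cast refl (sym (substI-unfold σ m D ts)) (μg' t (wf-substI σ (μ m D ts) w))
incl-substI σ (μg {m} {D} {F} {ts} w d) = cast refl (sym (substI-vecEnv σ ts F)) (μg (wf-substI σ (μ m D ts) w)
  (cast (substI-substP1 (liftSub m σ) m _ D ∙ cong (λ G → substP1 m G (substI (liftSub m σ) D)) (substI-wkParams m σ F))
        refl (incl-substI (liftSub m σ) d)))

incl-renI : ∀ {E g A B} h → Incl E g A B → Incl E g (renI h A) (renI h B)
incl-renI {A = A} {B} h d = cast (sym (renI≗substI h A)) (sym (renI≗substI h B)) (incl-substI (var ∘ h) d)

incl-renP : ∀ {E g A B} f → Incl E g A B → Incl E g (renP f A) (renP f B)
incl-renP f (ax {A} w) = ax (wf-renP f A w)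
incl-renP f (arr d d') = arr (incl-renP f d) (incl-renP f d')
incl-renP f (alliL {A} t d) = alliL t (cast (renP-substI f _ A) refl (incl-renP f d))
incl-renP f (alliR {A} d) = alliR (cast (renP-renI f suc A) refl (incl-renP f d))
incl-renP f (allpL {n} {A} G w d) = allpL (renP f G) (wf-renP f G w) (cast (renP-substP1 f n G A) refl (incl-renP f d))
incl-renP f (allpR {n} {A} d) = allpR (cast (renP-liftPR-shift n f A) refl (incl-renP (liftPR n f) d))
incl-renP f (eqn {A} {B} {u} {w} p d) = cast refl (sym (renP-substI f _ B)) (eqn p (cast refl (renP-substI f _ B) (incl-renP f d)))
incl-renP f (trans d d') = trans (incl-renP f d) (incl-renP f d')
incl-renP f (μd {m} {D} {ts} w) = cast (sym (renP-unfold f m D ts)) refl (μd (wf-renP f (μ m D ts) w))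
incl-renP f (μg' {m} {D} {ts} t w) = cast refl (sym (renP-unfold f m D ts)) (μg' t (wf-renP f (μ m D ts) w))
incl-renP f (μg {m} {D} {F} {ts} w d) = cast refl (sym (renP-substI f _ F)) (μg (wf-renP f (μ m D ts) w)
  (cast (renP-substP1 f m _ D ∙ cong (λ G → substP1 m G (renP (liftPR m f) D)) (renP-renI f _ F)) refl (incl-renP f d)))

-- ⊆ is a congruence for the quantifiers: introduce ∀ on the right, then
-- instantiate the left ∀ by the fresh variable (resp. predicate).

inst1I-var0-lift : ∀ X → inst1I (var zero) (renI (liftRen 1 suc) X) ≡ X
inst1I-var0-lift X = cong (substI _) (renI≗substI _ X) ∙ substI-∘ _ _ X ∙ substI-ext pt X ∙ substI-id X
  where
  pt : ∀ j → substT (vecEnv (var zero ∷ []) var) (var (liftRen 1 suc j)) ≡ var j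
  pt zero = refl
  pt (suc j) = refl

incl-∀i : ∀ {E g X Y} → Incl E g X Y → Incl E g (∀i X) (∀i Y)
incl-∀i {X = X} d = alliR (alliL (var zero) (cast (sym (inst1I-var0-lift X)) refl d))

substP1-bound-shift : ∀ m X → substP1 m (atom m zero (allVars m)) (renP (liftPR m (shiftPR m)) X) ≡ X
substP1-bound-shift m X = substP-renP _ _ X ∙ substP-id pt X
  where
  bound-atom : Formula
  bound-atom = atom m zero (allVars m)
  pt : (λ n k → inst1 m bound-atom n (liftPR m (shiftPR m) n k)) ≐ idPSub
  pt n k with predIndex m n k
  ... | bound = cong (inst1 m _ m) (liftPR-eq m (shiftPR m) zero) ∙ inst1-eq0 m bound-atom
  ... | outer k = cong (inst1 m _ m) (liftPR-eq m (shiftPR m) (suc k) ∙ cong suc (shift-eq m k)) ∙ inst1-eqS m bound-atom (suc k)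
  ... | other k ne = cong (inst1 m _ n) (liftPR-neq m (shiftPR m) n k ne ∙ shift-neq m n k ne) ∙ inst1-neq m bound-atom n k ne

incl-∀p : ∀ {E g X Y} m → Incl E g X Y → Incl E g (∀p m X) (∀p m Y)
incl-∀p {X = X} m d = allpR (allpL (atom m zero (allVars m)) tt (cast (sym (substP1-bound-shift m X)) refl d))

-- Monotonicity.  A sign s selects positivity or negativity, and the
-- direction of the inclusion that is to be proved.

data Sign : Set where
  plus minus : Sign

opposite : Sign → Sign
opposite plus = minus
opposite minus = plus

Polar : Sign → ℕ → ℕ → Formula → Set
Polar plus = Pos
Polar minus = Neg

InclDir : (Term → Term → Set) → Bool → Sign → Formula → Formula → Set
InclDir E g plus A B = Incl E g A B
InclDir E g minus A B = Incl E g B A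

pol-⇒₁ : ∀ s n k A B → Polar s n k (A ⇒ B) → Polar (opposite s) n k A
pol-⇒₁ plus n k A B p = proj₁ p
pol-⇒₁ minus n k A B p = proj₁ p

pol-⇒₂ : ∀ s n k A B → Polar s n k (A ⇒ B) → Polar s n k B
pol-⇒₂ plus n k A B p = proj₂ p
pol-⇒₂ minus n k A B p = proj₂ p

pol-∀i : ∀ s n k A → Polar s n k (∀i A) → Polar s n k A
pol-∀i plus n k A p = p
pol-∀i minus n k A p = p

pol-∀p : ∀ s n k m A → Polar s n k (∀p m A) → Polar s n (shiftPR m n k) A
pol-∀p plus n k m A p = p
pol-∀p minus n k m A p = p

pol-μ : ∀ s n k m A ts → Polar s n k (μ m A ts) → Polar s n (shiftPR m n k) A
pol-μ plus n k m A ts p = p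
pol-μ minus n k m A ts p = p

dir-refl : ∀ {E g} s X → WF X → InclDir E g s X X
dir-refl plus X w = ax w
dir-refl minus X w = ax w

dir-cast : ∀ {E g} s {A A' B B'} → A ≡ A' → B ≡ B' → InclDir E g s A B → InclDir E g s A' B'
dir-cast s refl refl d = d

dir-∀i : ∀ {E g} s {X Y} → InclDir E g s X Y → InclDir E g s (∀i X) (∀i Y)
dir-∀i plus d = incl-∀i d
dir-∀i minus d = incl-∀i d

dir-∀p : ∀ {E g} s m {X Y} → InclDir E g s X Y → InclDir E g s (∀p m X) (∀p m Y)
dir-∀p plus m d = incl-∀p m d
dir-∀p minus m d = incl-∀p m d

RelatedAt : (Term → Term → Set) → Bool → Sign → Formula → PSub → PSub → ℕ → ℕ → Set
RelatedAt E g s D ρ₁ ρ₂ n k = (ρ₁ n k ≡ ρ₂ n k) ⊎ (Polar s n k D × Incl E g (ρ₁ n k) (ρ₂ n k))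

Related : (Term → Term → Set) → Bool → Sign → Formula → PSub → PSub → Set
Related E g s D ρ₁ ρ₂ = ∀ n k → RelatedAt E g s D ρ₁ ρ₂ n k

related-inst1 : ∀ {E g} s n D A B → Polar s n zero D → Incl E g A B → Related E g s D (inst1 n A) (inst1 n B)
related-inst1 s n D A B pol d m k with predIndex n m k
... | bound = inj₂ (pol , cast (sym (inst1-eq0 n A)) (sym (inst1-eq0 n B)) d)
... | outer k = inj₁ (inst1-eqS n A k ∙ sym (inst1-eqS n B k))
... | other k ne = inj₁ (inst1-neq n A m k ne ∙ sym (inst1-neq n B m k ne))

-- Relatedness passes to subformulas and through lifted substitutions
-- (the polarity transport `pp` describes how the subformula sits in D).

Related-⇒₁ : ∀ {E g} s A B ρ₁ ρ₂ → Related E g s (A ⇒ B) ρ₁ ρ₂ → Related E g (opposite s) A ρ₁ ρ₂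
Related-⇒₁ s A B ρ₁ ρ₂ h n k with h n k
... | inj₁ e = inj₁ e
... | inj₂ (p , d) = inj₂ (pol-⇒₁ s n k A B p , d)

Related-⇒₂ : ∀ {E g} s A B ρ₁ ρ₂ → Related E g s (A ⇒ B) ρ₁ ρ₂ → Related E g s B ρ₁ ρ₂
Related-⇒₂ s A B ρ₁ ρ₂ h n k with h n k
... | inj₁ e = inj₁ e
... | inj₂ (p , d) = inj₂ (pol-⇒₂ s n k A B p , d)

Related-liftPSI : ∀ {E g} s i A A' ρ₁ ρ₂ → (∀ n k → Polar s n k A' → Polar s n k A) →
  Related E g s A' ρ₁ ρ₂ → Related E g s A (liftPSI i ρ₁) (liftPSI i ρ₂)
Related-liftPSI s i A A' ρ₁ ρ₂ pp h n k with h n k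
... | inj₁ e = inj₁ (cong (renI _) e)
... | inj₂ (p , d) = inj₂ (pp n k p , incl-renI _ d)

RelatedAt-shift : ∀ {E g} s m A A' ρ₁ ρ₂ n k → (Polar s n k A' → Polar s n (shiftPR m n k) A) →
  RelatedAt E g s A' ρ₁ ρ₂ n k → RelatedAt E g s A (liftPSP m ρ₁) (liftPSP m ρ₂) n (shiftPR m n k)
RelatedAt-shift s m A A' ρ₁ ρ₂ n k pp (inj₁ e) =
  inj₁ (liftPSP-shift m ρ₁ n k ∙ cong (renP _) e ∙ sym (liftPSP-shift m ρ₂ n k))
RelatedAt-shift s m A A' ρ₁ ρ₂ n k pp (inj₂ (p , d)) =
  inj₂ (pp p , cast (sym (liftPSP-shift m ρ₁ n k)) (sym (liftPSP-shift m ρ₂ n k)) (incl-renP _ d))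

Related-liftPSP : ∀ {E g} s m A A' ρ₁ ρ₂ → (∀ n k → Polar s n k A' → Polar s n (shiftPR m n k) A) →
  Related E g s A' ρ₁ ρ₂ → Related E g s A (liftPSP m ρ₁) (liftPSP m ρ₂)
Related-liftPSP {E} {g} s m A A' ρ₁ ρ₂ pp h n k with predIndex m n k
... | bound = inj₁ (liftPSP-eq0 m ρ₁ ∙ sym (liftPSP-eq0 m ρ₂))
... | outer k = subst (RelatedAt E g s A (liftPSP m ρ₁) (liftPSP m ρ₂) m) (shift-eq m k)
  (RelatedAt-shift s m A A' ρ₁ ρ₂ m k (pp m k) (h m k))
... | other k ne = subst (RelatedAt E g s A (liftPSP m ρ₁) (liftPSP m ρ₂) n) (shift-neq m n k ne)
  (RelatedAt-shift s m A A' ρ₁ ρ₂ n k (pp n k) (h n k))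

liftRen-wk-comm : ∀ m i → liftRen m (liftRen m (m +_)) (liftRen m (m +_) i) ≡ liftRen m (m +_) (liftRen m (m +_) i)
liftRen-wk-comm m i with split m i
... | lo i' = cong (liftRen m _) (liftRen-lo m _ i') ∙ liftRen-lo m _ i' ∙
    sym (cong (liftRen m _) (liftRen-lo m _ i') ∙ liftRen-lo m _ i')
... | hi q = cong (liftRen m _) (liftRen-+ m (m +_) q) ∙ liftRen-+ m _ (m + q) ∙
    cong (m +_) (liftRen-+ m (m +_) q) ∙ sym (cong (liftRen m (m +_)) (liftRen-+ m (m +_) q) ∙ liftRen-+ m (m +_) (m + q))

wkParams-μParam : ∀ m A → wkParams m (μParam m A) ≡ μParam m (wkParams m A)
wkParams-μParam m A = cong₂ (μ m) (renI-∘ _ _ A ∙ renI-ext (liftRen-wk-comm m) A ∙ sym (renI-∘ _ _ A))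
  (map-allVars-ren _ (liftRen-lo m (m +_)))

substI-wkParams-wk : ∀ m Y → substI (liftSub m (var ∘ liftRen m (m +_))) (wkParams m Y) ≡ wkParams m (wkParams m Y)
substI-wkParams-wk m Y = substI-ext (liftSub-ext m (λ j → sym (liftSub-var m (m +_) j))) (wkParams m Y) ∙
  substI-wkParams m (var ∘ (m +_)) Y ∙ cong (wkParams m) (substI-ext (liftSub-var m (m +_)) Y ∙ sym (renI≗substI _ Y))

vecEnv-allVars-wk : ∀ m X → substI (vecEnv (allVars m) var) (renI (liftRen m (m +_)) X) ≡ X
vecEnv-allVars-wk m X = cong (substI _) (renI≗substI _ X) ∙ substI-∘ _ _ X ∙ substI-ext pt X ∙ substI-id X
  where
  pt : ∀ i → substT (vecEnv (allVars m) var) (var (liftRen m (m +_) i)) ≡ var i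
  pt i with split m i
  ... | lo i' = cong (vecEnv (allVars m) var) (liftRen-lo m _ i') ∙ vecEnv-lo (allVars m) var i' ∙ lookup∘tabulate _ i'
  ... | hi q = cong (vecEnv (allVars m) var) (liftRen-+ m _ q) ∙ vecEnv-+ (allVars m) var (m + q)

-- The unfolding of μParam m A (the conclusion of μd for it) is A with C
-- replaced by μParam m A itself.
unfold-wkParams : ∀ m A → unfold m (wkParams m A) (allVars m) ≡ substP1 m (wkParams m (μParam m A)) A
unfold-wkParams m A = cong (substI _) (sym weakened) ∙ vecEnv-allVars-wk m _
  where
  open ≡-Reasoning
  r : ℕ → ℕ
  r = liftRen m (m +_)
  M : Formula
  M = wkParams m (μParam m A)
  weakened : renI r (substP1 m M A) ≡ substP1 m (wkParams m (μParam m (wkParams m A))) (wkParams m A)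
  weakened = begin
      renI r (substP1 m M A)
    ≡⟨ renI≗substI r _ ⟩
      substI (var ∘ r) (substP1 m M A)
    ≡⟨ substI-substP1 (var ∘ r) m M A ⟩
      substP1 m (substI (liftSub m (var ∘ r)) M) (substI (var ∘ r) A)
    ≡⟨ cong₂ (substP1 m) (substI-wkParams-wk m (μParam m A) ∙ cong (wkParams m) (wkParams-μParam m A))
                         (sym (renI≗substI r A)) ⟩
      substP1 m (wkParams m (μParam m (wkParams m A))) (wkParams m A)
    ∎

vecEnv-μParam : ∀ m A (ts : Vec Term m) → substI (vecEnv ts var) (μParam m A) ≡ μ m A ts
vecEnv-μParam m A ts = cong₂ (μ m)
  (cong (substI _) (renI≗substI _ A) ∙ substI-∘ _ _ A ∙ substI-ext (vecEnv-cancels-wk ts m) A ∙ substI-id A)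
  (map-allVars-env ts var)

wf-μParam : ∀ m A ts → WF (μ m A ts) → WF (μParam m A)
wf-μParam m A ts (o , p , w) = occurs-renI _ m zero A o , pos-renI _ m zero A p , wf-renI _ A w

-- μ is monotone in its body: μg with F := μ C x̄ A₂ ⟨x̄⟩ needs
-- A₁[F/C] ⊆ F, which is A₁[F/C] ⊆ A₂[F/C] followed by μd.
incl-μ-body : ∀ {E g} m A₁ A₂ (ts : Vec Term m) → WF (μ m A₁ ts) → WF (μ m A₂ ts) →
  (∀ G → WF G → Incl E g (substP1 m G A₁) (substP1 m G A₂)) → Incl E g (μ m A₁ ts) (μ m A₂ ts)
incl-μ-body m A₁ A₂ ts w₁ w₂ h = cast refl (vecEnv-μParam m A₂ ts) (μg w₁ (trans body-step unfold-step))
  where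
  wF : WF (μParam m A₂)
  wF = wf-μParam m A₂ ts w₂
  body-step : Incl _ _ (substP1 m (wkParams m (μParam m A₂)) A₁) (substP1 m (wkParams m (μParam m A₂)) A₂)
  body-step = h (wkParams m (μParam m A₂)) (wf-renI _ (μParam m A₂) wF)
  unfold-step : Incl _ _ (substP1 m (wkParams m (μParam m A₂)) A₂) (μParam m A₂)
  unfold-step = cast (unfold-wkParams m A₂) refl (μd wF)

dir-μ : ∀ {E g} s m {A₁ A₂} (ts : Vec Term m) → WF (μ m A₁ ts) → WF (μ m A₂ ts) →
  (∀ G → WF G → InclDir E g s (substP1 m G A₁) (substP1 m G A₂)) → InclDir E g s (μ m A₁ ts) (μ m A₂ ts)
dir-μ plus m ts w₁ w₂ h = incl-μ-body m _ _ ts w₁ w₂ h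
dir-μ minus m ts w₁ w₂ h = incl-μ-body m _ _ ts w₂ w₁ h

-- Substitution into the body of μ with its bound predicate then
-- instantiated by G: A[ρ lifted past C][G/C] = A[instLifted m ρ G].
instLifted : ℕ → PSub → Formula → PSub
instLifted m ρ G = liftPSP m ρ ⊛ inst1 m G

substP-inst1-shift : ∀ j m G X → substP (liftPSI j (inst1 m G)) (renP (shiftPR m) X) ≡ X
substP-inst1-shift j m G X = substP-renP _ _ X ∙ substP-id pt X
  where
  pt : (λ p i → liftPSI j (inst1 m G) p (shiftPR m p i)) ≐ idPSub
  pt p i with p ≟ m
  ... | yes refl = cong (λ x → renI _ (inst1 p G p x)) (shift-eq p i) ∙ cong (renI _) (inst1-eqS p G i) ∙ liftPSI-id j p i
  ... | no ne = cong (λ x → renI _ (inst1 m G p x)) (shift-neq m p i ne) ∙ cong (renI _) (inst1-neq m G p i ne) ∙ liftPSI-id j p i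

instLifted-shift : ∀ m ρ G n k → instLifted m ρ G n (shiftPR m n k) ≡ ρ n k
instLifted-shift m ρ G n k = cong (substP _) (liftPSP-shift m ρ n k) ∙ substP-inst1-shift n m G (ρ n k)

wfSub-instLifted : ∀ m ρ G → WFSub ρ → WF G → WFSub (instLifted m ρ G)
wfSub-instLifted m ρ G wr w n k =
  wf-substP (liftPSI n (inst1 m G)) (liftPSP m ρ n k) (wfSub-liftPSI n (inst1 m G) (wfSub-inst1 m G w)) (wfSub-liftPSP m ρ wr n k)

RelatedAt-instLifted : ∀ {E g} s m A ts ρ₁ ρ₂ G n k → RelatedAt E g s (μ m A ts) ρ₁ ρ₂ n k →
  RelatedAt E g s A (instLifted m ρ₁ G) (instLifted m ρ₂ G) n (shiftPR m n k)
RelatedAt-instLifted s m A ts ρ₁ ρ₂ G n k (inj₁ e) =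
  inj₁ (instLifted-shift m ρ₁ G n k ∙ e ∙ sym (instLifted-shift m ρ₂ G n k))
RelatedAt-instLifted s m A ts ρ₁ ρ₂ G n k (inj₂ (p , d)) =
  inj₂ (pol-μ s n k m A ts p , cast (sym (instLifted-shift m ρ₁ G n k)) (sym (instLifted-shift m ρ₂ G n k)) d)

Related-instLifted : ∀ {E g} s m A ts ρ₁ ρ₂ G → Related E g s (μ m A ts) ρ₁ ρ₂ →
  Related E g s A (instLifted m ρ₁ G) (instLifted m ρ₂ G)
Related-instLifted {E} {g} s m A ts ρ₁ ρ₂ G h n k with predIndex m n k
... | bound = inj₁ (cong (substP _) (liftPSP-eq0 m ρ₁ ∙ sym (liftPSP-eq0 m ρ₂)))
... | outer k = subst (RelatedAt E g s A (instLifted m ρ₁ G) (instLifted m ρ₂ G) m) (shift-eq m k)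
  (RelatedAt-instLifted s m A ts ρ₁ ρ₂ G m k (h m k))
... | other k ne = subst (RelatedAt E g s A (instLifted m ρ₁ G) (instLifted m ρ₂ G) n) (shift-neq m n k ne)
  (RelatedAt-instLifted s m A ts ρ₁ ρ₂ G n k (h n k))

-- Monotonicity for simultaneous substitutions, by induction on D.  No
-- rule (μ'_g) is introduced, so the result holds for every flag g.
monotone : ∀ {E g} s D ρ₁ ρ₂ → WF D → WFSub ρ₁ → WFSub ρ₂ → Related E g s D ρ₁ ρ₂ →
  InclDir E g s (substP ρ₁ D) (substP ρ₂ D)
monotone s ⊥f ρ₁ ρ₂ w w₁ w₂ h = dir-refl s ⊥f tt
monotone s (atom n k ts) ρ₁ ρ₂ w w₁ w₂ h with h n k
... | inj₁ e = dir-cast s (cong (substI (vecEnv ts var)) (sym e)) refl (dir-refl s _ (wf-substI _ (ρ₂ n k) (w₂ n k)))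
monotone plus (atom n k ts) ρ₁ ρ₂ w w₁ w₂ h | inj₂ (p , d) = incl-substI _ d
monotone minus (atom n k ts) ρ₁ ρ₂ w w₁ w₂ h | inj₂ (p , d) = ⊥-elim (p (refl , refl))
monotone plus (A ⇒ B) ρ₁ ρ₂ (w , v) w₁ w₂ h =
  arr (monotone minus A ρ₁ ρ₂ w w₁ w₂ (Related-⇒₁ plus A B ρ₁ ρ₂ h)) (monotone plus B ρ₁ ρ₂ v w₁ w₂ (Related-⇒₂ plus A B ρ₁ ρ₂ h))
monotone minus (A ⇒ B) ρ₁ ρ₂ (w , v) w₁ w₂ h =
  arr (monotone plus A ρ₁ ρ₂ w w₁ w₂ (Related-⇒₁ minus A B ρ₁ ρ₂ h)) (monotone minus B ρ₁ ρ₂ v w₁ w₂ (Related-⇒₂ minus A B ρ₁ ρ₂ h))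
monotone s (∀i A) ρ₁ ρ₂ w w₁ w₂ h = dir-∀i s (monotone s A _ _ w (wfSub-liftPSI 1 ρ₁ w₁) (wfSub-liftPSI 1 ρ₂ w₂)
  (Related-liftPSI s 1 A (∀i A) ρ₁ ρ₂ (λ n k → pol-∀i s n k A) h))
monotone s (∀p m A) ρ₁ ρ₂ w w₁ w₂ h = dir-∀p s m (monotone s A _ _ w (wfSub-liftPSP m ρ₁ w₁) (wfSub-liftPSP m ρ₂ w₂)
  (Related-liftPSP s m A (∀p m A) ρ₁ ρ₂ (λ n k → pol-∀p s n k m A) h))
monotone s (μ m A ts) ρ₁ ρ₂ wμ w₁ w₂ h =
  -- compare the bodies after instantiating C by an arbitrary G; these are
  -- A under the substitutions instLifted m (liftPSI m ρᵢ) G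
  dir-μ s m ts (wf-substP ρ₁ (μ m A ts) w₁ wμ) (wf-substP ρ₂ (μ m A ts) w₂ wμ) λ G wG →
    dir-cast s (sym (substP-∘ (inst1 m G) _ A)) (sym (substP-∘ (inst1 m G) _ A))
      (monotone s A (instLifted m (liftPSI m ρ₁) G) (instLifted m (liftPSI m ρ₂) G) (proj₂ (proj₂ wμ))
        (wfSub-instLifted m _ G (wfSub-liftPSI m ρ₁ w₁) wG) (wfSub-instLifted m _ G (wfSub-liftPSI m ρ₂ w₂) wG)
        (Related-instLifted s m A ts _ _ G (Related-liftPSI s m (μ m A ts) (μ m A ts) ρ₁ ρ₂ (λ _ _ p → p) h)))

monotone-inst1 : ∀ {E g} s n D A B → WF D → WF A → WF B → Incl E g A B → Polar s n zero D →
  InclDir E g s (substP1 n A D) (substP1 n B D)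
monotone-inst1 s n D A B wD wA wB A⊆B pol =
  monotone s D (inst1 n A) (inst1 n B) wD (wfSub-inst1 n A wA) (wfSub-inst1 n B wB) (related-inst1 s n D A B pol A⊆B)

-- With U the unfolding of μ (as a formula in the parameters), μg needs
-- D[U/C] ⊆ U.  μd gives U ⊆ μ, hence D[U/C] ⊆ D[μ/C] = U by monotonicity
-- in the positive C.
μg'-eliminable : ∀ {E g} m D (ts : Vec Term m) → WF (μ m D ts) → Incl E g (μ m D ts) (unfold m D ts)
μg'-eliminable {E} {g} m D ts wμ@(_ , C-pos , wD) = μg wμ premise
  where
  M U : Formula
  M = wkParams m (μParam m D)
  U = substP1 m M D
  wM : WF M
  wM = wf-renI _ (μParam m D) (wf-μParam m D ts wμ)
  wU : WF U
  wU = wf-substP (inst1 m M) D (wfSub-inst1 m M wM) wD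
  U⊆μ : Incl E g (wkParams m U) M
  U⊆μ = incl-renI _ (cast (unfold-wkParams m D) refl (μd (wf-μParam m D ts wμ)))
  premise : Incl E g (substP1 m (wkParams m U) D) U
  premise = monotone-inst1 plus m D (wkParams m U) M wD (wf-renI _ U wU) wM U⊆μ C-pos

lemma4p3 : (E : Term → Term → Set) →
    ((n : ℕ) (D A B : Formula) → WF D → WF A → WF B → Incl E true A B →
       (Pos n zero D → Incl E true (substP1 n A D) (substP1 n B D)) ×
       (Neg n zero D → Incl E true (substP1 n B D) (substP1 n A D)))
    × ((m : ℕ) (D : Formula) (ts : Vec Term m) → WF (μ m D ts) →
       Incl E false (μ m D ts) (unfold m D ts))
lemma4p3 E = monotonicity , μg'-eliminable
  where
  monotonicity : (n : ℕ) (D A B : Formula) → WF D → WF A → WF B → Incl E true A B →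
    (Pos n zero D → Incl E true (substP1 n A D) (substP1 n B D)) ×
    (Neg n zero D → Incl E true (substP1 n B D) (substP1 n A D))
  monotonicity n D A B wD wA wB A⊆B =
    monotone-inst1 plus n D A B wD wA wB A⊆B , monotone-inst1 minus n D A B wD wA wB A⊆B
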